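{- Let $K$ be a closed $n$-dimensional pseudo-manifold with $n\ge1$ which carries a shellable $h$-tiling. Then $\mu(K)\ge2$, with equality if and only if $K$ is shellable.
   Context: A closed $n$-dimensional pseudo-manifold is a finite simplicial complex all of whose maximal simplices (facets) have dimension $n$ and each of whose $(n-1)$-dimensional faces (ridges) is contained in exactly two facets. $K$ is shellable (in the classical sense) if its facets can be ordered $\sigma_1,\dots,\sigma_N$ so that for each $p\in\{1,\dots,N-1\}$, $\sigma_{p+1}\cap(\sigma_1\cup\dots\cup\sigma_p)$ is a nonempty union of ridges of $\sigma_{p+1}$. A relative simplex is a simplex deprived of some proper faces. A basic tile of dimension $n$ and order $k\in\{0,\dots,n+1\}$ is an $n$-simplex deprived of $k$ ridges; it has a unique face of least dimension $k-1$. A critical tile of dimension $n$ and index $k\in\{0,\dots,n\}$ is a basic tile of order $k$ deprived moreover of that $(k-1)$-dimensional face (index $0$: closed simplex, index $n$: open simplex). A tiling of $K$ is a partition of $|K|$ into relative simplices whose underlying simplices are simplices of $K$, such that for every $d\ge0$ the union of tiles of dimension $>d$ is closed in $|K|$; it is shellable if its tiles can be ordered $T_1,\dots,T_N$ with each $T_1\cup\dots\cup T_p$ closed. An $h$-tiling is a tiling all of whose tiles are basic or critical tiles. $\mu(K)$ denotes the minimum, over all shellable $h$-tilings of $K$, of the number of critical tiles they use. -}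

module Defs where

open import Level using (Level)
open import Data.Nat using (ℕ; zero; suc; _+_; _<_; _≤_)
open import Data.Fin using (Fin)
open import Data.Fin.Subset using (Subset; _∈_; _⊆_; _-_; ∣_∣; Nonempty)
open import Data.List using (List; []; _∷_; _++_; take; length; lookup)
open import Data.List.Relation.Unary.All using (All)
open import Data.List.Relation.Unary.Any using (Any)
open import Data.List.Relation.Unary.Unique.Propositional using (Unique)
import Data.List.Membership.Propositional as LM
open import Data.Product using (Σ; ∃; ∃-syntax; _×_)
open import Data.Sum using (_⊎_)
open import Relation.Nullary using (¬_; Dec)
open import Relation.Binary.PropositionalEquality using (_≡_; _≢_)
open import Function.Bundles using (_⇔_)

-- Finite simplicial complexes on the vertex set Fin v.
-- A simplex is a nonempty subset of Fin v; dim σ = ∣ σ ∣ - 1.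

record SimplicialComplex (v : ℕ) : Set₁ where
  field
    face       : Subset v → Set
    face?      : (σ : Subset v) → Dec (face σ)
    nonempty   : ∀ {σ} → face σ → Nonempty σ
    downClosed : ∀ {σ ρ} → face σ → ρ ⊆ σ → Nonempty ρ → face ρ
open SimplicialComplex public

module _ {v : ℕ} (K : SimplicialComplex v) where

  Facet : Subset v → Set
  Facet σ = face K σ × (∀ ρ → face K ρ → σ ⊆ ρ → ρ ≡ σ)

  ClosedPseudoManifold : ℕ → Set
  ClosedPseudoManifold n =
    (∃[ σ ] Facet σ) ×
    (∀ σ → Facet σ → ∣ σ ∣ ≡ suc n) ×
    (∀ ρ → face K ρ → ∣ ρ ∣ ≡ n →
      ∃[ σ₁ ] ∃[ σ₂ ] (σ₁ ≢ σ₂ × Facet σ₁ × Facet σ₂ × ρ ⊆ σ₁ × ρ ⊆ σ₂ ×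
        (∀ σ → Facet σ → ρ ⊆ σ → σ ≡ σ₁ ⊎ σ ≡ σ₂)))

Ridge : ∀ {v} → Subset v → Subset v → Set
Ridge ρ σ = ρ ⊆ σ × suc ∣ ρ ∣ ≡ ∣ σ ∣

-- Classical shellability condition for σ_{p+1} = σ with respect to the
-- closed simplices listed in pre = σ_1 … σ_p:  σ ∩ (σ_1 ∪ … ∪ σ_p) is a
-- nonempty union of ridges of σ.  (Faces of this intersection are the
-- nonempty τ ⊆ σ with τ ⊆ σ_i for some i ≤ p.)
ShellStep : ∀ {v} → List (Subset v) → Subset v → Set
ShellStep pre σ =
  (∃[ τ ] (Nonempty τ × τ ⊆ σ × Any (τ ⊆_) pre)) ×
  (∀ τ → Nonempty τ → τ ⊆ σ → Any (τ ⊆_) pre →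
     ∃[ ρ ] (Ridge ρ σ × τ ⊆ ρ × Any (ρ ⊆_) pre))

Shellable : ∀ {v} → SimplicialComplex v → Set
Shellable {v} K = ∃[ σs ]
  (All (Facet K) σs × (∀ σ → Facet K σ → σ LM.∈ σs) × Unique σs ×
   (∀ pre σ post → σs ≡ pre ++ σ ∷ post → pre ≢ [] → ShellStep pre σ))

-- Subsets of |K| that are unions of open simplices are represented by
-- predicates on simplices; such a union is closed in |K| iff it is
-- closed under passing to (nonempty) faces.

Closed : ∀ {v ℓ} → (Subset v → Set ℓ) → Set ℓ
Closed C = ∀ τ ρ → C τ → Nonempty ρ → ρ ⊆ τ → C ρ

-- A tile: an underlying simplex together with the set of (open) faces it
-- contains.
record Tile (v : ℕ) : Set₁ where
  field
    simplex : Subset v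
    cell    : Subset v → Set
open Tile public

BasicCells : ∀ {v} → Subset v → Subset v → Subset v → Set
BasicCells σ S τ = Nonempty τ × τ ⊆ σ × (∀ x → x ∈ S → ¬ (τ ⊆ σ - x))

-- Basic tile of order k = ∣ S ∣ ∈ {0,…,n+1}: σ deprived of k ridges.
IsBasicTile : ∀ {v} → Tile v → Set
IsBasicTile {v} t = ∃[ S ] (S ⊆ simplex t ×
  (∀ τ → cell t τ ⇔ BasicCells (simplex t) S τ))

-- Critical tile of index k = ∣ S ∣ ∈ {0,…,n}: basic tile of order k
-- deprived moreover of its least face S (the closed face S).
IsCriticalTile : ∀ {v} → Tile v → Set
IsCriticalTile {v} t = ∃[ S ] (S ⊆ simplex t × ∣ S ∣ < ∣ simplex t ∣ ×
  (∀ τ → cell t τ ⇔ (BasicCells (simplex t) S τ × ¬ (τ ⊆ S))))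

Union : ∀ {v} → List (Tile v) → Subset v → Set₁
Union ts τ = Any (λ t → cell t τ) ts

UnionDimAbove : ∀ {v} → ℕ → List (Tile v) → Subset v → Set₁
UnionDimAbove d ts τ = Any (λ t → suc d < ∣ simplex t ∣ × cell t τ) ts

module _ {v : ℕ} (K : SimplicialComplex v) where

  HTiling : List (Tile v) → Set₁
  HTiling ts =
    All (λ t → face K (simplex t) × (IsBasicTile t ⊎ IsCriticalTile t)) ts ×
    (∀ τ → face K τ → ∃[ i ] cell (lookup ts i) τ) ×
    (∀ τ i j → cell (lookup ts i) τ → cell (lookup ts j) τ → i ≡ j) ×
    (∀ τ → Union ts τ → face K τ) ×
    (∀ d → Closed (UnionDimAbove d ts))

  ShellableHTiling : List (Tile v) → Set₁
  ShellableHTiling ts = HTiling ts × (∀ p → Closed (Union (take p ts)))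

data CountCritical {v : ℕ} : List (Tile v) → ℕ → Set₁ where
  cnt-[] : CountCritical [] 0
  cnt-yes : ∀ {t ts c} → IsCriticalTile t → CountCritical ts c →
            CountCritical (t ∷ ts) (suc c)
  cnt-no  : ∀ {t ts c} → ¬ IsCriticalTile t → CountCritical ts c →
            CountCritical (t ∷ ts) c

IsMu : ∀ {v} → SimplicialComplex v → ℕ → Set₁
IsMu {v} K m =
  (∃[ ts ] (ShellableHTiling K ts × CountCritical ts m)) ×
  (∀ ts c → ShellableHTiling K ts → CountCritical ts c → m ≤ c)

module Submission where

-- In a shellable h-tiling of a closed pseudomanifold every tile is a facet; the first tile
-- is a closed simplex and the last one an open simplex, because each ridge of the last facet
-- is shared with an earlier facet. Hence μ(K) ≥ 2. If these are the only critical tiles,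
-- every other tile is a facet σ deprived of a nonempty set of ridges σ - x, x ∈ S, and σ
-- meets the earlier tiles exactly in these ridges: the facets in tile order form a shelling.
--
-- Conversely, a shelling gives the h-tiling whose tiles are the facets minus their
-- intersections with the earlier facets. Its first tile is closed, its last one open, and
-- every other tile is basic of an order strictly between 0 and n + 1: the restriction of a
-- facet is nonempty by the shelling condition, and it is not the whole facet unless the
-- facet comes last. Indeed, a full restriction at σ lets one build, going down the shelling,
-- a mod-2 n-cycle on σ and the facets before it (∂∂ = 0 around codimension-two faces makes
-- all missing ridges of a facet agree). In a pseudomanifold an n-cycle is closed under
-- adjacency across ridges, and a shelling is strongly connected, so the cycle would also
-- contain the facets after σ.

open import Defs
open import Data.Bool using (Bool; true; false; not; _∧_; _xor_)
import Data.Bool as Bool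
open import Data.Bool.Properties using (xor-∧-commutativeRing; ∧-zeroʳ; xor-identityʳ; ¬-not)
open import Algebra.Bundles using (CommutativeRing)
open import Algebra.Properties.Semiring.Sum (CommutativeRing.semiring xor-∧-commutativeRing)
  using (sum-syntax; sum-cong-≗; sum-replicate-zero; sum-remove; ∑-comm; *-distribˡ-sum)
open import Data.Nat using (ℕ; zero; suc; pred; _+_; _<_; _≤_; >-nonZero)
open import Data.Nat.Properties
  using (n<1+n; ≤-antisym; ≤-trans; ≤-reflexive; <⇒≱; suc-injective; +-suc; +-monoʳ-≤; m≤m+n; +-cancelʳ-≡; +-cancelˡ-≡;
         suc-pred)
open import Data.Fin using (Fin; zero; suc; punchIn; punchOut)
import Data.Fin.Properties as Fin
open import Data.Fin.Properties using (any?; _≟_; punchInᵢ≢i; punchIn-punchOut; punchIn-injective)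
open import Data.Fin.Subset using (Subset; inside; outside; _∈_; _∉_; _⊆_; _─_; _-_; _∪_; ∣_∣; Nonempty; ⁅_⁆; ⊥)
open import Data.Fin.Subset.Properties
  using (_∈?_; _⊆?_; ⊆-antisym; p⊂q⇒∣p∣<∣q∣; p⊆q⇒∣p∣≤∣q∣; ∣p∣≤n; drop-there; x∈⁅x⁆; x∈⁅y⁆⇒x≡y;
         x∈p∧x≢y⇒x∈p-y; x∈p∧x∉q⇒x∈p─q; p─x─y≡p─y─x; p─q⊆p; p─⊥≡p; p⊆p∪q; drop-∷-⊆; ⊥⊆; ∉⊥; x∈p∪q⁺; x∈p∪q⁻;
         nonempty?; Empty-unique; ∣⊥∣≡0)
import Data.Vec.Base as Vec
open import Data.Vec.Base using (_∷_; []; tabulate)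
open import Data.Vec.Properties using ([]=⇒lookup; lookup⇒[]=; lookup∘tabulate; ≡-dec)
open import Data.List using (List; []; _∷_; _++_; _∷ʳ_; map; take; length; lookup)
open import Data.List.Membership.Propositional using (find; lose) renaming (_∈_ to _∈ₗ_; _∉_ to _∉ₗ_)
open import Data.List.Membership.Propositional.Properties using (∈-lookup; ∈-++⁺ˡ; ∈-++⁺ʳ; ∈-++⁻; ∈-map⁺)
open import Data.List.Properties using (++-assoc; ++-identityʳ; ∷-injective; ∷-injectiveˡ; ∷-injectiveʳ)
open import Data.List.Reverse using (Reverse; []; _∶_∶ʳ_; reverseView)
open import Data.List.Relation.Unary.All using (All; []; _∷_)
import Data.List.Relation.Unary.All as All
import Data.List.Relation.Unary.All.Properties as All
open import Data.List.Relation.Unary.Any using (Any; here; there)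
import Data.List.Relation.Unary.Any as Any
import Data.List.Relation.Unary.Any.Properties as Any
open import Data.List.Relation.Unary.AllPairs using (AllPairs; []; _∷_)
open import Data.List.Relation.Unary.Unique.Propositional using (Unique)
open import Data.Product using (∃; ∃-syntax; _×_; _,_; proj₁; proj₂; map₂)
open import Data.Sum using (_⊎_; inj₁; inj₂; swap)
open import Data.Empty using (⊥-elim)
open import Function using (_∘_; case_of_)
open import Function.Bundles using (_⇔_; mk⇔; module Equivalence)
open Equivalence using (to; from)
open import Relation.Nullary using (¬_; Dec; yes; no; does)
open import Relation.Nullary.Decidable using (_×-dec_; ¬?; decidable-stable; dec-true; dec-false; does-⇔)
open import Relation.Unary using (Decidable)
open import Relation.Binary.PropositionalEquality
  using (_≡_; _≢_; refl; sym; trans; cong; cong₂; subst; subst₂; module ≡-Reasoning)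

private
  variable
    v : ℕ
    p q ρ τ : Subset v
    x y : Fin v

x∈p─q⇒x∉q : ∀ {p q : Subset v} {x} → x ∈ p ─ q → x ∉ q
x∈p─q⇒x∉q {p = _ ∷ _} {outside ∷ _} {zero} _ ()
x∈p─q⇒x∉q {p = _ ∷ _} {inside ∷ _} {zero} () Vec.here
x∈p─q⇒x∉q {p = _ ∷ _} {_ ∷ _} {suc _} x∈p─q (Vec.there x∈q) = x∈p─q⇒x∉q (drop-there x∈p─q) x∈q

x∈p-y⇒x≢y : x ∈ p - y → x ≢ y
x∈p-y⇒x≢y {y = y} x∈p-y refl = x∈p─q⇒x∉q x∈p-y (x∈⁅x⁆ y)

p-x⊆p : ∀ (p : Subset v) x → p - x ⊆ p
p-x⊆p p x = p─q⊆p p ⁅ x ⁆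

⊆∧∉⇒⊆- : q ⊆ p → x ∉ q → q ⊆ p - x
⊆∧∉⇒⊆- q⊆p x∉q y∈q = x∈p∧x≢y⇒x∈p-y (q⊆p y∈q) λ { refl → x∉q y∈q }

⊆-⇒∉ : q ⊆ p - x → x ∉ q
⊆-⇒∉ q⊆p-x x∈q = x∈p-y⇒x≢y (q⊆p-x x∈q) refl

⊆∧⊈-⇒∈ : q ⊆ p → ¬ (q ⊆ p - x) → x ∈ q
⊆∧⊈-⇒∈ {q = q} {x = x} q⊆p q⊈p-x = decidable-stable (x ∈? q) (q⊈p-x ∘ ⊆∧∉⇒⊆- q⊆p)

suc∣p-x∣≡∣p∣ : ∀ (p : Subset v) → x ∈ p → suc ∣ p - x ∣ ≡ ∣ p ∣
suc∣p-x∣≡∣p∣ (inside ∷ p) Vec.here = cong (suc ∘ ∣_∣) (p─⊥≡p p)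
suc∣p-x∣≡∣p∣ (inside ∷ p) (Vec.there x∈p) = cong suc (suc∣p-x∣≡∣p∣ p x∈p)
suc∣p-x∣≡∣p∣ (outside ∷ p) (Vec.there x∈p) = suc∣p-x∣≡∣p∣ p x∈p

⊈⇒∃∉ : ¬ (p ⊆ q) → ∃ λ x → x ∈ p × x ∉ q
⊈⇒∃∉ {p = p} {q = q} p⊈q with any? (λ x → x ∈? p ×-dec ¬? (x ∈? q))
... | yes witness = witness
... | no none = ⊥-elim (p⊈q λ {x} x∈p → decidable-stable (x ∈? q) λ x∉q → none (x , x∈p , x∉q))

⊆∧∣≥∣⇒≡ : p ⊆ q → ∣ q ∣ ≤ ∣ p ∣ → p ≡ q
⊆∧∣≥∣⇒≡ {p = p} {q = q} p⊆q ∣q∣≤∣p∣ with q ⊆? p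
... | yes q⊆p = ⊆-antisym p⊆q q⊆p
... | no q⊈p = ⊥-elim (<⇒≱ (p⊂q⇒∣p∣<∣q∣ (p⊆q , ⊈⇒∃∉ q⊈p)) ∣q∣≤∣p∣)

x∈p⇒Ridge : x ∈ p → Ridge (p - x) p
x∈p⇒Ridge {p = p} x∈p = p-x⊆p p _ , suc∣p-x∣≡∣p∣ p x∈p

Ridge⇒≡- : ∀ {ρ σ : Subset v} → Ridge ρ σ → ∃ λ x → x ∈ σ × ρ ≡ σ - x
Ridge⇒≡- {ρ = ρ} {σ} (ρ⊆σ , ∣ρ∣+1≡∣σ∣) with ⊈⇒∃∉ {p = σ} {q = ρ} (λ σ⊆ρ → <⇒≱ (≤-reflexive ∣ρ∣+1≡∣σ∣) (p⊆q⇒∣p∣≤∣q∣ σ⊆ρ))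
... | x , x∈σ , x∉ρ = x , x∈σ , ⊆∧∣≥∣⇒≡ (⊆∧∉⇒⊆- ρ⊆σ x∉ρ)
                                        (≤-reflexive (suc-injective (trans (suc∣p-x∣≡∣p∣ σ x∈σ) (sym ∣ρ∣+1≡∣σ∣))))

0<∣p∣⇒Nonempty : ∀ {v} {p : Subset v} → 0 < ∣ p ∣ → Nonempty p
0<∣p∣⇒Nonempty {v = v} {p = p} 0<∣p∣ with nonempty? p
... | yes ne = ne
... | no empty = ⊥-elim (<⇒≱ 0<∣p∣ (≤-reflexive (trans (cong ∣_∣ (Empty-unique empty)) (∣⊥∣≡0 v))))

x∈p∪⁅x⁆ : x ∈ p ∪ ⁅ x ⁆
x∈p∪⁅x⁆ {x = x} = x∈p∪q⁺ (inj₂ (x∈⁅x⁆ x))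

∣p∣<∣p∪⁅x⁆∣ : x ∉ p → ∣ p ∣ < ∣ p ∪ ⁅ x ⁆ ∣
∣p∣<∣p∪⁅x⁆∣ x∉p = p⊂q⇒∣p∣<∣q∣ (p⊆p∪q _ , _ , x∈p∪⁅x⁆ , x∉p)

∪⁅⁆-⊆ : p ⊆ q → x ∈ q → p ∪ ⁅ x ⁆ ⊆ q
∪⁅⁆-⊆ {p = p} {x = x} p⊆q x∈q y∈ with x∈p∪q⁻ p ⁅ x ⁆ y∈
... | inj₁ y∈p = p⊆q y∈p
... | inj₂ y∈⁅x⁆ = subst (_∈ _) (sym (x∈⁅y⁆⇒x≡y x y∈⁅x⁆)) x∈q

p-x-y⊆p : ∀ (p : Subset v) x y → p - x - y ⊆ p
p-x-y⊆p p x y z∈ = p-x⊆p p x (p-x⊆p (p - x) y z∈)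

x∈p∧x≢y∧x≢z⇒x∈p-y-z : ∀ {z} → x ∈ p → x ≢ y → x ≢ z → x ∈ p - y - z
x∈p∧x≢y∧x≢z⇒x∈p-y-z x∈p x≢y x≢z = x∈p∧x≢y⇒x∈p-y (x∈p∧x≢y⇒x∈p-y x∈p x≢y) x≢z

x∈q⇒q⊈p-x : x ∈ q → ¬ (q ⊆ p - x)
x∈q⇒q⊈p-x x∈q q⊆p-x = ⊆-⇒∉ q⊆p-x x∈q

⊆∧∀⊈-⇒≡ : ∀ {τ σ : Subset v} → τ ⊆ σ → (∀ x → x ∈ σ → ¬ (τ ⊆ σ - x)) → τ ≡ σ
⊆∧∀⊈-⇒≡ τ⊆σ τ⊈σ-x = ⊆-antisym τ⊆σ λ x∈σ → ⊆∧⊈-⇒∈ τ⊆σ (τ⊈σ-x _ x∈σ)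

∣p∣≡∣p─q∣+∣q∣ : ∀ (p q : Subset v) → q ⊆ p → ∣ p ∣ ≡ ∣ p ─ q ∣ + ∣ q ∣
∣p∣≡∣p─q∣+∣q∣ [] [] _ = refl
∣p∣≡∣p─q∣+∣q∣ (inside ∷ p) (inside ∷ q) q⊆p = trans (cong suc (∣p∣≡∣p─q∣+∣q∣ p q (drop-∷-⊆ q⊆p))) (sym (+-suc _ _))
∣p∣≡∣p─q∣+∣q∣ (inside ∷ p) (outside ∷ q) q⊆p = cong suc (∣p∣≡∣p─q∣+∣q∣ p q (drop-∷-⊆ q⊆p))
∣p∣≡∣p─q∣+∣q∣ (outside ∷ p) (outside ∷ q) q⊆p = ∣p∣≡∣p─q∣+∣q∣ p q (drop-∷-⊆ q⊆p)
∣p∣≡∣p─q∣+∣q∣ (outside ∷ p) (inside ∷ q) q⊆p with q⊆p Vec.here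
... | ()

p-x∪⁅x⁆≡p : ∀ {p : Subset v} {x} → x ∈ p → (p - x) ∪ ⁅ x ⁆ ≡ p
p-x∪⁅x⁆≡p {p = p} {x} x∈p = ⊆-antisym (∪⁅⁆-⊆ (p-x⊆p p x) x∈p) p⊆
  where
    p⊆ : p ⊆ (p - x) ∪ ⁅ x ⁆
    p⊆ {y} y∈p with y ≟ x
    ... | yes refl = x∈p∪⁅x⁆
    ... | no y≢x = p⊆p∪q _ (x∈p∧x≢y⇒x∈p-y y∈p y≢x)

p∪⁅x⁆-x≡p : ∀ {p : Subset v} {x} → x ∉ p → p ∪ ⁅ x ⁆ - x ≡ p
p∪⁅x⁆-x≡p {p = p} {x} x∉p = ⊆-antisym ⊆p λ y∈p → ⊆∧∉⇒⊆- (p⊆p∪q _) x∉p y∈p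
  where
    ⊆p : p ∪ ⁅ x ⁆ - x ⊆ p
    ⊆p {y} y∈ with x∈p∪q⁻ p ⁅ x ⁆ (p-x⊆p _ x y∈)
    ... | inj₁ y∈p = y∈p
    ... | inj₂ y∈⁅x⁆ = ⊥-elim (x∈p-y⇒x≢y y∈ (x∈⁅y⁆⇒x≡y x y∈⁅x⁆))

∣p∪⁅x⁆∣≡suc∣p∣ : ∀ {p : Subset v} {x} → x ∉ p → ∣ p ∪ ⁅ x ⁆ ∣ ≡ suc ∣ p ∣
∣p∪⁅x⁆∣≡suc∣p∣ {p = p} {x} x∉p =
  trans (sym (suc∣p-x∣≡∣p∣ (p ∪ ⁅ x ⁆) x∈p∪⁅x⁆)) (cong (suc ∘ ∣_∣) (p∪⁅x⁆-x≡p x∉p))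

∣p∣≡2+∣p-x-y∣ : ∀ {p : Subset v} {x y} → x ∈ p → y ∈ p → x ≢ y → ∣ p ∣ ≡ 2 + ∣ p - x - y ∣
∣p∣≡2+∣p-x-y∣ {p = p} {x} {y} x∈p y∈p x≢y =
  trans (sym (suc∣p-x∣≡∣p∣ p x∈p)) (cong suc (sym (suc∣p-x∣≡∣p∣ (p - x) (x∈p∧x≢y⇒x∈p-y y∈p (x≢y ∘ sym)))))

∈-tabulate⇔ : ∀ {P : Fin v → Set} (P? : Decidable P) → x ∈ tabulate (does ∘ P?) ⇔ P x
∈-tabulate⇔ {x = x} P? = mk⇔
  (λ x∈ → witness (P? x) (trans (sym (lookup∘tabulate (does ∘ P?) x)) ([]=⇒lookup x∈)))
  (λ Px → lookup⇒[]= x _ (trans (lookup∘tabulate (does ∘ P?) x) (dec-true (P? x) Px)))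
  where
    witness : ∀ {A : Set} (a? : Dec A) → does a? ≡ true → A
    witness (yes a) _ = a

_≟ˢ_ : (p q : Subset v) → Dec (p ≡ q)
_≟ˢ_ = ≡-dec Bool._≟_

module _ {a r} {A : Set a} {R : A → A → Set r} where

  AllPairs-++⁻ˡ : ∀ xs {ys} → AllPairs R (xs ++ ys) → AllPairs R xs
  AllPairs-++⁻ˡ [] _ = []
  AllPairs-++⁻ˡ (_ ∷ xs) (rx ∷ rs) = All.++⁻ˡ xs rx ∷ AllPairs-++⁻ˡ xs rs

  AllPairs-++⇒All-All : ∀ xs {ys} → AllPairs R (xs ++ ys) → All (λ x → All (R x) ys) xs
  AllPairs-++⇒All-All [] _ = []
  AllPairs-++⇒All-All (_ ∷ xs) (rx ∷ rs) = All.++⁻ʳ xs rx ∷ AllPairs-++⇒All-All xs rs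

∉-∷ʳ : ∀ {a} {A : Set a} {P : List A} {τ} → Unique (P ∷ʳ τ) → τ ∉ₗ P
∉-∷ʳ {P = P} unique τ∈P = All.lookup (All.lookup (AllPairs-++⇒All-All P unique) τ∈P) (here refl) refl

∈-split : ∀ {a} {A : Set a} {xs ys zs : List A} {x} → xs ≡ ys ++ x ∷ zs → x ∈ₗ xs
∈-split {ys = ys} refl = ∈-++⁺ʳ ys (here refl)

∷-∷ʳ-view : ∀ {a} {A : Set a} (xs : List A) → xs ≢ [] → (∀ x → xs ≢ x ∷ []) → ∃ λ x₀ → ∃ λ M → ∃ λ x₁ → xs ≡ x₀ ∷ M ∷ʳ x₁
∷-∷ʳ-view [] xs≢[] _ = ⊥-elim (xs≢[] refl)
∷-∷ʳ-view (x₀ ∷ rest) _ not-single with reverseView rest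
... | [] = ⊥-elim (not-single x₀ refl)
... | M ∶ _ ∶ʳ x₁ = x₀ , M , x₁ , refl

∷ʳ≢[] : ∀ {a} {A : Set a} (xs : List A) {x} → xs ∷ʳ x ≢ []
∷ʳ≢[] [] ()
∷ʳ≢[] (_ ∷ _) ()

∈-init : ∀ {a} {A : Set a} (xs ys : List A) {y t b zs} → xs ∷ʳ y ≡ ys ++ t ∷ b ∷ zs → t ∈ₗ xs
∈-init (x ∷ xs) [] eq = here (sym (∷-injectiveˡ eq))
∈-init (x ∷ xs) (_ ∷ ys) eq = there (∈-init xs ys (∷-injectiveʳ eq))
∈-init [] [] ()
∈-init [] (_ ∷ []) ()
∈-init [] (_ ∷ _ ∷ _) ()

take-length-++ : ∀ {a} {A : Set a} (xs : List A) {ys} → take (length xs) (xs ++ ys) ≡ xs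
take-length-++ [] = refl
take-length-++ (x ∷ xs) = cong (x ∷_) (take-length-++ xs)

Any-⊆ˡ : ∀ {L} → p ⊆ q → Any (q ⊆_) L → Any (p ⊆_) L
Any-⊆ˡ p⊆q = Any.map λ q⊆G {x} x∈p → q⊆G (p⊆q x∈p)

module _ {a b} {A : Set a} {B : Set b} (f : A → B) where

  map≡++∷⁻ : ∀ {xs} pre {y post} → map f xs ≡ pre ++ y ∷ post →
    ∃ λ As → ∃ λ x → ∃ λ Bs → xs ≡ As ++ x ∷ Bs × map f As ≡ pre × f x ≡ y
  map≡++∷⁻ {[]} [] ()
  map≡++∷⁻ {[]} (_ ∷ _) ()
  map≡++∷⁻ {x ∷ xs} [] refl = [] , x , xs , refl , refl , refl
  map≡++∷⁻ {x ∷ xs} (_ ∷ pre) eq with ∷-injective eq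
  ... | refl , eq′ with map≡++∷⁻ pre eq′
  ...   | As , x′ , Bs , refl , refl , refl = x ∷ As , x′ , Bs , refl , refl , refl

∑-∈ : ∀ {m} (p : Subset m) → ∑[ w < m ] does (w ∈? p) ≡ ∑[ i < ∣ p ∣ ] true
∑-∈ [] = refl
∑-∈ (inside ∷ p) = cong (true xor_) (∑-∈ p)
∑-∈ (outside ∷ p) = ∑-∈ p

∑-single : ∀ {m} (i : Fin m) (f : Fin m → Bool) → (∀ j → j ≢ i → f j ≡ false) → ∑[ j < m ] f j ≡ f i
∑-single {suc m} i f vanish = begin
  ∑[ j < suc m ] f j                       ≡⟨ sum-remove {i = i} f ⟩
  f i xor ∑[ j < m ] f (punchIn i j)       ≡⟨ cong (f i xor_) (sum-cong-≗ λ j → vanish _ (punchInᵢ≢i i j)) ⟩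
  f i xor ∑[ j < m ] false                 ≡⟨ cong (f i xor_) (sum-replicate-zero m) ⟩
  f i xor false                            ≡⟨ xor-identityʳ (f i) ⟩
  f i                                      ∎
  where open ≡-Reasoning

∑-pair : ∀ {m} {i j : Fin m} (f : Fin m → Bool) → i ≢ j → (∀ k → k ≢ i → k ≢ j → f k ≡ false) →
  ∑[ k < m ] f k ≡ f i xor f j
∑-pair {suc m} {i} {j} f i≢j vanish = begin
  ∑[ k < suc m ] f k                            ≡⟨ sum-remove {i = i} f ⟩
  f i xor ∑[ k < m ] f (punchIn i k)            ≡⟨ cong (f i xor_) (∑-single (punchOut i≢j) (f ∘ punchIn i) vanish′) ⟩
  f i xor f (punchIn i (punchOut i≢j))          ≡⟨ cong (λ k → f i xor f k) (punchIn-punchOut i≢j) ⟩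
  f i xor f j                                   ∎
  where
    open ≡-Reasoning
    vanish′ : ∀ k → k ≢ punchOut i≢j → f (punchIn i k) ≡ false
    vanish′ k k≢ = vanish _ (punchInᵢ≢i i k) λ ik≡j →
      k≢ (punchIn-injective i k _ (trans ik≡j (sym (punchIn-punchOut i≢j))))

xor≡false⇒≡ : ∀ a b → a xor b ≡ false → a ≡ b
xor≡false⇒≡ false false _ = refl
xor≡false⇒≡ true true _ = refl

module _ (K : SimplicialComplex v) where

  face⇒⊆Facet : face K τ → ∃ λ F → Facet K F × τ ⊆ F
  face⇒⊆Facet {τ = τ} = grow v (m≤m+n v ∣ τ ∣)
    where
      grow : ∀ k {τ} → v ≤ k + ∣ τ ∣ → face K τ → ∃ λ F → Facet K F × τ ⊆ F
      grow k {τ} v≤k+∣τ∣ τ∈K with any? (λ y → ¬? (y ∈? τ) ×-dec face? K (τ ∪ ⁅ y ⁆))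
      ... | no unextendable = τ , (τ∈K , maximal) , λ x∈τ → x∈τ
        where
          maximal : ∀ ρ → face K ρ → τ ⊆ ρ → ρ ≡ τ
          maximal ρ ρ∈K τ⊆ρ with ρ ⊆? τ
          ... | yes ρ⊆τ = ⊆-antisym ρ⊆τ τ⊆ρ
          ... | no ρ⊈τ with ⊈⇒∃∉ ρ⊈τ
          ... | y , y∈ρ , y∉τ =
            ⊥-elim (unextendable (y , y∉τ , downClosed K ρ∈K (∪⁅⁆-⊆ τ⊆ρ y∈ρ) (y , x∈p∪⁅x⁆)))
      ... | yes (y , y∉τ , τ+y∈K) with k
      ...   | zero = ⊥-elim (<⇒≱ (≤-trans (∣p∣<∣p∪⁅x⁆∣ y∉τ) (∣p∣≤n (τ ∪ ⁅ y ⁆))) v≤k+∣τ∣)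
      ...   | suc k′ with grow k′ (≤-trans v≤k+∣τ∣ (≤-trans (≤-reflexive (sym (+-suc k′ ∣ τ ∣)))
                                                      (+-monoʳ-≤ k′ (∣p∣<∣p∪⁅x⁆∣ y∉τ)))) τ+y∈K
      ...     | F , F-facet , τ+y⊆F = F , F-facet , τ+y⊆F ∘ p⊆p∪q _

module PseudoManifold (K : SimplicialComplex v) {n} (1≤n : 1 ≤ n) (pm : ClosedPseudoManifold K n) where

  facet-size : ∀ {F} → Facet K F → ∣ F ∣ ≡ suc n
  facet-size {F} F-facet = proj₁ (proj₂ pm) F F-facet

  ridge-size : ∀ {F} → Facet K F → x ∈ F → ∣ F - x ∣ ≡ n
  ridge-size F-facet x∈F = suc-injective (trans (suc∣p-x∣≡∣p∣ _ x∈F) (facet-size F-facet))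

  ridge-nonempty : ∀ {F} → Facet K F → x ∈ F → Nonempty (F - x)
  ridge-nonempty F-facet x∈F = 0<∣p∣⇒Nonempty (subst (0 <_) (sym (ridge-size F-facet x∈F)) 1≤n)

  ridge-face : ∀ {F} → Facet K F → x ∈ F → face K (F - x)
  ridge-face F-facet x∈F = downClosed K (proj₁ F-facet) (p-x⊆p _ _) (ridge-nonempty F-facet x∈F)

  two-facets : ∃ λ F → ∃ λ G → Facet K F × Facet K G × F ≢ G
  two-facets with proj₁ pm
  ... | F , F-facet with nonempty K (proj₁ F-facet)
  ... | x , x∈F with proj₂ (proj₂ pm) (F - x) (ridge-face F-facet x∈F) (ridge-size F-facet x∈F)
  ... | G₁ , G₂ , G₁≢G₂ , G₁-facet , G₂-facet , _ = G₁ , G₂ , G₁-facet , G₂-facet , G₁≢G₂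

  opposite-facet : ∀ {F} → face K ρ → ∣ ρ ∣ ≡ n → Facet K F → ρ ⊆ F →
    ∃ λ G → Facet K G × G ≢ F × ρ ⊆ G × (∀ H → Facet K H → ρ ⊆ H → H ≡ F ⊎ H ≡ G)
  opposite-facet {ρ = ρ} {F} ρ∈K ∣ρ∣≡n F-facet ρ⊆F with proj₂ (proj₂ pm) ρ ρ∈K ∣ρ∣≡n
  ... | G₁ , G₂ , G₁≢G₂ , G₁-facet , G₂-facet , ρ⊆G₁ , ρ⊆G₂ , only with only F F-facet ρ⊆F
  ...   | inj₁ refl = G₂ , G₂-facet , G₁≢G₂ ∘ sym , ρ⊆G₂ , only
  ...   | inj₂ refl = G₁ , G₁-facet , G₁≢G₂ , ρ⊆G₁ , λ H H-facet ρ⊆H → swap (only H H-facet ρ⊆H)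

  proper-face⇒other-facet : ∀ {σ} → Facet K σ → τ ⊆ σ → ¬ (σ ⊆ τ) → ∃ λ G → Facet K G × G ≢ σ × τ ⊆ G
  proper-face⇒other-facet σ-facet τ⊆σ σ⊈τ with ⊈⇒∃∉ σ⊈τ
  ... | x , x∈σ , x∉τ with opposite-facet (ridge-face σ-facet x∈σ) (ridge-size σ-facet x∈σ) σ-facet (p-x⊆p _ x)
  ... | G , G-facet , G≢σ , σ-x⊆G , _ = G , G-facet , G≢σ , λ y∈τ → σ-x⊆G (⊆∧∉⇒⊆- τ⊆σ x∉τ y∈τ)

IsHTile : Tile v → Set
IsHTile t = IsBasicTile t ⊎ IsCriticalTile t

IsClosedTile : Tile v → Set
IsClosedTile t = ∀ τ → cell t τ ⇔ (Nonempty τ × τ ⊆ simplex t)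

IsOpenTile : Tile v → Set
IsOpenTile t = ∀ τ → cell t τ ⇔ τ ≡ simplex t

module _ {t : Tile v} where

  HTile-cell⇒⊆ : IsHTile t → cell t τ → Nonempty τ × τ ⊆ simplex t
  HTile-cell⇒⊆ (inj₁ (_ , _ , cells)) c = map₂ proj₁ (to (cells _) c)
  HTile-cell⇒⊆ (inj₂ (_ , _ , _ , cells)) c = map₂ proj₁ (proj₁ (to (cells _) c))

  HTile-simplex∈cell : IsHTile t → Nonempty (simplex t) → cell t (simplex t)
  HTile-simplex∈cell (inj₁ (S , S⊆σ , cells)) ne =
    from (cells _) (ne , (λ x∈σ → x∈σ) , λ x x∈S → x∈q⇒q⊈p-x (S⊆σ x∈S))
  HTile-simplex∈cell (inj₂ (S , S⊆σ , ∣S∣<∣σ∣ , cells)) ne =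
    from (cells _) ((ne , (λ x∈σ → x∈σ) , λ x x∈S → x∈q⇒q⊈p-x (S⊆σ x∈S)) ,
                    λ σ⊆S → <⇒≱ ∣S∣<∣σ∣ (p⊆q⇒∣p∣≤∣q∣ σ⊆S))

  closed⇒critical : Nonempty (simplex t) → IsClosedTile t → IsCriticalTile t
  closed⇒critical (x , x∈σ) closed = ⊥ , ⊥⊆ , p⊂q⇒∣p∣<∣q∣ (⊥⊆ , x , x∈σ , ∉⊥) , λ τ → mk⇔ (to′ τ) (from′ τ)
    where
      to′ : ∀ τ → cell t τ → BasicCells (simplex t) ⊥ τ × ¬ (τ ⊆ ⊥)
      to′ τ c with to (closed τ) c
      ... | (y , y∈τ) , τ⊆σ = ((y , y∈τ) , τ⊆σ , λ _ → ⊥-elim ∘ ∉⊥) , λ τ⊆⊥ → ∉⊥ (τ⊆⊥ y∈τ)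
      from′ : ∀ τ → BasicCells (simplex t) ⊥ τ × ¬ (τ ⊆ ⊥) → cell t τ
      from′ τ ((ne , τ⊆σ , _) , _) = from (closed τ) (ne , τ⊆σ)

  open⇒critical : x ∈ simplex t → IsOpenTile t → IsCriticalTile t
  open⇒critical {x = x₀} x₀∈σ open′ =
    σ - x₀ , p-x⊆p σ x₀ , ≤-reflexive (suc∣p-x∣≡∣p∣ σ x₀∈σ) , λ τ → mk⇔ (to′ τ) (from′ τ)
    where
      σ = simplex t
      to′ : ∀ τ → cell t τ → BasicCells σ (σ - x₀) τ × ¬ (τ ⊆ σ - x₀)
      to′ τ c with to (open′ τ) c
      ... | refl = ((x₀ , x₀∈σ) , (λ y∈σ → y∈σ) , λ y y∈σ-x₀ → x∈q⇒q⊈p-x (p-x⊆p σ x₀ y∈σ-x₀)) , x∈q⇒q⊈p-x x₀∈σ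
      from′ : ∀ τ → BasicCells σ (σ - x₀) τ × ¬ (τ ⊆ σ - x₀) → cell t τ
      from′ τ ((_ , τ⊆σ , τ⊈σ-S) , τ⊈σ-x₀) = from (open′ τ) (⊆∧∀⊈-⇒≡ τ⊆σ τ⊈σ-y)
        where
          τ⊈σ-y : ∀ y → y ∈ σ → ¬ (τ ⊆ σ - y)
          τ⊈σ-y y y∈σ with y ≟ x₀
          ... | yes refl = τ⊈σ-x₀
          ... | no y≢x₀ = τ⊈σ-S y (x∈p∧x≢y⇒x∈p-y y∈σ y≢x₀)

  open⇒basic : Nonempty (simplex t) → IsOpenTile t → IsBasicTile t
  open⇒basic ne open′ = simplex t , (λ x∈σ → x∈σ) , λ τ → mk⇔ (to′ τ) (from′ τ)
    where
      to′ : ∀ τ → cell t τ → BasicCells (simplex t) (simplex t) τ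
      to′ τ c with to (open′ τ) c
      ... | refl = ne , (λ x∈σ → x∈σ) , λ x → x∈q⇒q⊈p-x
      from′ : ∀ τ → BasicCells (simplex t) (simplex t) τ → cell t τ
      from′ τ (_ , τ⊆σ , τ⊈σ-x) = from (open′ τ) (⊆∧∀⊈-⇒≡ τ⊆σ τ⊈σ-x)

  noncritical⇒basic : IsHTile t → Nonempty (simplex t) → ¬ IsCriticalTile t →
    ∃ λ S → S ⊆ simplex t × Nonempty S × (∀ τ → cell t τ ⇔ BasicCells (simplex t) S τ)
  noncritical⇒basic (inj₂ critical) _ noncritical = ⊥-elim (noncritical critical)
  noncritical⇒basic (inj₁ (S , S⊆σ , cells)) σ-nonempty noncritical with nonempty? S
  ... | yes S-nonempty = S , S⊆σ , S-nonempty , cells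
  ... | no S-empty = ⊥-elim (noncritical (closed⇒critical σ-nonempty closed))
    where
      closed : IsClosedTile t
      closed τ = mk⇔ (λ τ∈t → map₂ proj₁ (to (cells τ) τ∈t))
                     (λ (τ-nonempty , τ⊆σ) → from (cells τ) (τ-nonempty , τ⊆σ , λ x x∈S → ⊥-elim (S-empty (x , x∈S))))

  -- The least face S of the basic tile is a cell, which forces the removed face S′ of a
  -- critical structure to satisfy S′ ⊊ S; then S′ ∪ {y} with y ∉ S is a cell of the
  -- critical tile lying in a removed ridge σ - z, z ∈ S ∖ S′.
  basic⇒¬critical : (S : Subset v) → S ⊆ simplex t → (∀ τ → cell t τ ⇔ BasicCells (simplex t) S τ) →
    Nonempty S → ∃ (λ y → y ∈ simplex t × y ∉ S) → ¬ IsCriticalTile t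
  basic⇒¬critical S S⊆σ cells (w , w∈S) (y , y∈σ , y∉S) (S′ , S′⊆σ , _ , cells′) =
    proj₂ (proj₂ (to (cells S′+y) S′+y∈t)) z z∈S (⊆∧∉⇒⊆- S′+y⊆σ z∉S′+y)
    where
      S∈t = to (cells′ S) (from (cells S) ((w , w∈S) , S⊆σ , λ x → x∈q⇒q⊈p-x))
      S′⊆S : S′ ⊆ S
      S′⊆S x∈S′ = ⊆∧⊈-⇒∈ S⊆σ (proj₂ (proj₂ (proj₁ S∈t)) _ x∈S′)
      z-witness = ⊈⇒∃∉ (proj₂ S∈t)
      z = proj₁ z-witness
      z∈S = proj₁ (proj₂ z-witness)
      S′+y = S′ ∪ ⁅ y ⁆
      S′+y⊆σ : S′+y ⊆ simplex t
      S′+y⊆σ = ∪⁅⁆-⊆ S′⊆σ y∈σ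
      S′+y∈t : cell t S′+y
      S′+y∈t = from (cells′ S′+y) (((y , x∈p∪⁅x⁆) , S′+y⊆σ , λ x x∈S′ → x∈q⇒q⊈p-x (p⊆p∪q _ x∈S′)) ,
                              λ S′+y⊆S′ → y∉S (S′⊆S (S′+y⊆S′ x∈p∪⁅x⁆)))
      z∉S′+y : z ∉ S′+y
      z∉S′+y z∈S′+y with x∈p∪q⁻ S′ ⁅ y ⁆ z∈S′+y
      ... | inj₁ z∈S′ = proj₂ (proj₂ z-witness) z∈S′
      ... | inj₂ z∈⁅y⁆ = y∉S (subst (_∈ S) (x∈⁅y⁆⇒x≡y y z∈⁅y⁆) z∈S)

DisjointCells : Tile v → Tile v → Set
DisjointCells t t′ = ∀ {τ} → cell t τ → ¬ cell t′ τ

Partition : List (Tile v) → Set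
Partition ts = ∀ τ i j → cell (lookup ts i) τ → cell (lookup ts j) τ → i ≡ j

Partition⇒AllPairs : ∀ (ts : List (Tile v)) → Partition ts → AllPairs DisjointCells ts
Partition⇒AllPairs [] _ = []
Partition⇒AllPairs (t ∷ ts) partition =
  All.tabulate (λ t′∈ts τ∈t τ∈t′ →
    case partition _ zero (suc (Any.index t′∈ts)) τ∈t (subst (λ u → cell u _) (Any.lookup-index t′∈ts) τ∈t′) of λ ()) ∷
  Partition⇒AllPairs ts λ τ i j τ∈tᵢ τ∈tⱼ → Fin.suc-injective (partition τ (suc i) (suc j) τ∈tᵢ τ∈tⱼ)

AllPairs⇒Partition : ∀ (ts : List (Tile v)) → AllPairs DisjointCells ts → Partition ts
AllPairs⇒Partition (_ ∷ _) _ _ zero zero _ _ = refl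
AllPairs⇒Partition (_ ∷ _) (disjoint ∷ _) _ zero (suc j) τ∈t τ∈t′ = ⊥-elim (All.lookup disjoint (∈-lookup j) τ∈t τ∈t′)
AllPairs⇒Partition (_ ∷ _) (disjoint ∷ _) _ (suc i) zero τ∈t′ τ∈t = ⊥-elim (All.lookup disjoint (∈-lookup i) τ∈t τ∈t′)
AllPairs⇒Partition (_ ∷ ts) (_ ∷ disjoints) τ (suc i) (suc j) τ∈t τ∈t′ =
  cong suc (AllPairs⇒Partition ts disjoints τ i j τ∈t τ∈t′)

Partition⇒cell-unique : ∀ {ts : List (Tile v)} {t t′} → Partition ts → t ∈ₗ ts → t′ ∈ₗ ts → cell t τ → cell t′ τ → t ≡ t′
Partition⇒cell-unique {ts = ts} partition t∈ t′∈ τ∈t τ∈t′ =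
  trans (Any.lookup-index t∈)
        (trans (cong (lookup ts) (partition _ _ _ (subst (λ u → cell u _) (Any.lookup-index t∈) τ∈t)
                                                  (subst (λ u → cell u _) (Any.lookup-index t′∈) τ∈t′)))
               (sym (Any.lookup-index t′∈)))

distinct-simplices : ∀ {ts : List (Tile v)} → All (λ t → cell t (simplex t)) ts → AllPairs DisjointCells ts →
  Unique (map simplex ts)
distinct-simplices [] [] = []
distinct-simplices {ts = t ∷ _} (self ∷ selfs) (disjoint ∷ disjoints) =
  All.map⁺ (All.zipWith (λ (disjoint′ , self′) σ≡σ′ → disjoint′ (subst (cell t) σ≡σ′ self) self′) (disjoint , selfs)) ∷
  distinct-simplices selfs disjoints

CountCritical-∷ʳ⁻ : ∀ (xs : List (Tile v)) {t c} → CountCritical (xs ∷ʳ t) c → IsCriticalTile t →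
  ∃ λ c′ → c ≡ suc c′ × CountCritical xs c′
CountCritical-∷ʳ⁻ [] (cnt-yes _ cnt-[]) _ = 0 , refl , cnt-[]
CountCritical-∷ʳ⁻ [] (cnt-no ¬critical _) critical = ⊥-elim (¬critical critical)
CountCritical-∷ʳ⁻ (x ∷ xs) (cnt-yes x-critical count) critical with CountCritical-∷ʳ⁻ xs count critical
... | c′ , refl , count′ = suc c′ , refl , cnt-yes x-critical count′
CountCritical-∷ʳ⁻ (x ∷ xs) (cnt-no x-noncritical count) critical with CountCritical-∷ʳ⁻ xs count critical
... | c′ , refl , count′ = c′ , refl , cnt-no x-noncritical count′

CountCritical-∷ʳ⁺ : ∀ {xs : List (Tile v)} {t c} → CountCritical xs c → IsCriticalTile t → CountCritical (xs ∷ʳ t) (suc c)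
CountCritical-∷ʳ⁺ cnt-[] critical = cnt-yes critical cnt-[]
CountCritical-∷ʳ⁺ (cnt-yes x-critical count) critical = cnt-yes x-critical (CountCritical-∷ʳ⁺ count critical)
CountCritical-∷ʳ⁺ (cnt-no x-noncritical count) critical = cnt-no x-noncritical (CountCritical-∷ʳ⁺ count critical)

CountCritical-zero⇔ : ∀ {xs : List (Tile v)} → CountCritical xs 0 ⇔ All (¬_ ∘ IsCriticalTile) xs
CountCritical-zero⇔ = mk⇔ noncritical count
  where
    noncritical : ∀ {xs} → CountCritical xs 0 → All (¬_ ∘ IsCriticalTile) xs
    noncritical cnt-[] = []
    noncritical (cnt-no ¬critical count) = ¬critical ∷ noncritical count
    count : ∀ {xs} → All (¬_ ∘ IsCriticalTile) xs → CountCritical xs 0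
    count [] = cnt-[]
    count (¬critical ∷ ¬criticals) = cnt-no ¬critical (count ¬criticals)

CountCritical-ends⁻ : ∀ {t₀ t₁ : Tile v} M {c} → CountCritical (t₀ ∷ M ∷ʳ t₁) c → IsCriticalTile t₀ → IsCriticalTile t₁ →
  ∃ λ k → c ≡ 2 + k × CountCritical M k
CountCritical-ends⁻ M (cnt-no ¬critical _) t₀-critical _ = ⊥-elim (¬critical t₀-critical)
CountCritical-ends⁻ M (cnt-yes _ count) _ t₁-critical with CountCritical-∷ʳ⁻ M count t₁-critical
... | k , refl , count′ = k , refl , count′

CountCritical-ends⁺ : ∀ {t₀ t₁ : Tile v} {M} → All (¬_ ∘ IsCriticalTile) M → IsCriticalTile t₀ → IsCriticalTile t₁ →
  CountCritical (t₀ ∷ M ∷ʳ t₁) 2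
CountCritical-ends⁺ noncritical t₀-critical t₁-critical =
  cnt-yes t₀-critical (CountCritical-∷ʳ⁺ (from CountCritical-zero⇔ noncritical) t₁-critical)

-- Shellings

IsShelling : List (Subset v) → Set
IsShelling σs = ∀ pre σ post → σs ≡ pre ++ σ ∷ post → pre ≢ [] → ShellStep pre σ

IsShelling-++⁻ˡ : ∀ (P : List (Subset v)) {Q} → IsShelling (P ++ Q) → IsShelling P
IsShelling-++⁻ˡ P {Q} shelling pre σ post P≡ =
  shelling pre σ (post ++ Q) (trans (cong (_++ Q) P≡) (++-assoc pre (σ ∷ post) Q))

IsShelling-∷ʳ⁻ : ∀ {P : List (Subset v)} {τ} → IsShelling (P ∷ʳ τ) → IsShelling P × (P ≢ [] → ShellStep P τ)
IsShelling-∷ʳ⁻ {P = P} {τ} shelling = IsShelling-++⁻ˡ P shelling , shelling P τ [] refl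

IsShelling-map⁺ : ∀ {a} {A : Set a} (f : A → Subset v) xs →
  (∀ As x Bs → xs ≡ As ++ x ∷ Bs → As ≢ [] → ShellStep (map f As) (f x)) → IsShelling (map f xs)
IsShelling-map⁺ f xs step pre σ post eq pre≢[] with map≡++∷⁻ f pre eq
... | As , x , Bs , refl , refl , refl = step As x Bs refl λ { refl → pre≢[] refl }

restriction : List (Subset v) → Subset v → Subset v
restriction pre σ = tabulate (does ∘ λ x → x ∈? σ ×-dec Any.any? (σ - x ⊆?_) pre)

∈-restriction⇔ : ∀ {pre : List (Subset v)} {σ} → x ∈ restriction pre σ ⇔ (x ∈ σ × Any (σ - x ⊆_) pre)
∈-restriction⇔ {pre = pre} {σ} = ∈-tabulate⇔ λ x → x ∈? σ ×-dec Any.any? (σ - x ⊆?_) pre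

AttachedAlong : List (Subset v) → Subset v → Subset v → Set
AttachedAlong pre σ S = ∀ τ → Nonempty τ → τ ⊆ σ → Any (τ ⊆_) pre ⇔ ∃ λ x → x ∈ S × τ ⊆ σ - x

ShellStep⇒AttachedAlong-restriction : ∀ {pre : List (Subset v)} {σ} →
  (pre ≢ [] → ShellStep pre σ) → AttachedAlong pre σ (restriction pre σ)
ShellStep⇒AttachedAlong-restriction {pre = pre} {σ} step τ ne τ⊆σ = mk⇔ in-ridge in-pre
  where
    in-ridge : Any (τ ⊆_) pre → ∃ λ x → x ∈ restriction pre σ × τ ⊆ σ - x
    in-ridge τ∈pre with proj₂ (step λ { refl → case τ∈pre of λ () }) τ ne τ⊆σ τ∈pre
    ... | ρ , ρ-ridge , τ⊆ρ , ρ∈pre with Ridge⇒≡- ρ-ridge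
    ...   | x , x∈σ , refl = x , from (∈-restriction⇔ {pre = pre} {σ}) (x∈σ , ρ∈pre) , τ⊆ρ
    in-pre : (∃ λ x → x ∈ restriction pre σ × τ ⊆ σ - x) → Any (τ ⊆_) pre
    in-pre (x , x∈R , τ⊆σ-x) = Any-⊆ˡ τ⊆σ-x (proj₂ (to (∈-restriction⇔ {pre = pre} {σ}) x∈R))

AttachedAlong⇒ShellStep : ∀ {pre : List (Subset v)} {σ S} → AttachedAlong pre σ S → S ⊆ σ → Nonempty S →
  (∀ {x} → x ∈ σ → Nonempty (σ - x)) → ShellStep pre σ
AttachedAlong⇒ShellStep {pre = pre} {σ} {S} attached S⊆σ (x₀ , x₀∈S) ridges-nonempty =
  (σ - x₀ , ridge-nonempty x₀∈S , p-x⊆p σ x₀ , ridge∈pre x₀∈S) , in-ridge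
  where
    ridge-nonempty : ∀ {x} → x ∈ S → Nonempty (σ - x)
    ridge-nonempty = ridges-nonempty ∘ S⊆σ
    ridge∈pre : ∀ {x} → x ∈ S → Any (σ - x ⊆_) pre
    ridge∈pre {x} x∈S = from (attached (σ - x) (ridge-nonempty x∈S) (p-x⊆p σ x)) (x , x∈S , λ y∈ → y∈)
    in-ridge : ∀ τ → Nonempty τ → τ ⊆ σ → Any (τ ⊆_) pre → ∃ λ ρ → Ridge ρ σ × τ ⊆ ρ × Any (ρ ⊆_) pre
    in-ridge τ ne τ⊆σ τ∈pre with to (attached τ ne τ⊆σ) τ∈pre
    ... | x , x∈S , τ⊆σ-x = σ - x , x∈p⇒Ridge (S⊆σ x∈S) , τ⊆σ-x , ridge∈pre x∈S

-- The meet is nonempty: the shelling step provides a ridge τ - s of τ in P, and s ≠ x, y.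
missing-ridges⇒missing-meet : ∀ {P} {τ : Subset v} {x y} → (P ≢ [] → ShellStep P τ) → x ∈ τ → y ∈ τ → x ≢ y →
  ¬ Any (τ - x ⊆_) P → ¬ Any (τ - y ⊆_) P → ¬ Any (τ - x - y ⊆_) P
missing-ridges⇒missing-meet {τ = τ} {x} {y} step x∈τ y∈τ x≢y x-missing y-missing μ∈P
  with step (λ { refl → case μ∈P of λ () })
... | (τ′ , τ′-nonempty , τ′⊆τ , τ′∈P) , ridges with ridges τ′ τ′-nonempty τ′⊆τ τ′∈P
... | ρ , ρ-ridge , _ , ρ∈P with Ridge⇒≡- ρ-ridge
... | s , s∈τ , refl
  with ridges (τ - x - y) (s , x∈p∧x≢y∧x≢z⇒x∈p-y-z s∈τ (λ { refl → x-missing ρ∈P }) (λ { refl → y-missing ρ∈P }))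
              (p-x-y⊆p τ x y) μ∈P
... | ρ′ , ρ′-ridge , μ⊆ρ′ , ρ′∈P with Ridge⇒≡- ρ′-ridge
... | s′ , s′∈τ , refl with s′ ≟ x | s′ ≟ y
... | yes refl | _ = x-missing ρ′∈P
... | no _ | yes refl = y-missing ρ′∈P
... | no s′≢x | no s′≢y = ⊆-⇒∉ μ⊆ρ′ (x∈p∧x≢y∧x≢z⇒x∈p-y-z s′∈τ s′≢x s′≢y)

shelling-connected : ∀ {n} {L : List (Subset v)} → Reverse L → IsShelling L → All (λ F → ∣ F ∣ ≡ suc n) L →
  (C : Subset v → Set) → (∀ {F G ρ} → F ∈ₗ L → G ∈ₗ L → ∣ ρ ∣ ≡ n → ρ ⊆ F → ρ ⊆ G → C F → C G) →
  ∀ {F G} → F ∈ₗ L → G ∈ₗ L → C F → C G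
shelling-connected [] _ _ _ _ ()
shelling-connected {n = n} (L ∶ rest ∶ʳ τ) shelling sizes C adjacent F∈ G∈ = go (∈-++⁻ L F∈) (∈-++⁻ L G∈)
  where
    connected : ∀ {F G} → F ∈ₗ L → G ∈ₗ L → C F → C G
    connected = shelling-connected rest (proj₁ (IsShelling-∷ʳ⁻ shelling)) (All.++⁻ˡ L sizes) C
                  λ F∈ G∈ → adjacent (∈-++⁺ˡ F∈) (∈-++⁺ˡ G∈)
    τ∈L+τ : τ ∈ₗ L ∷ʳ τ
    τ∈L+τ = ∈-++⁺ʳ L (here refl)
    neighbour : ∀ {F} → F ∈ₗ L → ∃ λ H → H ∈ₗ L × ∃ λ ρ → ∣ ρ ∣ ≡ n × ρ ⊆ τ × ρ ⊆ H
    neighbour F∈L with proj₂ (IsShelling-∷ʳ⁻ shelling) (λ { refl → case F∈L of λ () })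
    ... | (τ′ , τ′-nonempty , τ′⊆τ , τ′∈L) , ridges with ridges τ′ τ′-nonempty τ′⊆τ τ′∈L
    ... | ρ , (ρ⊆τ , ∣ρ∣+1≡∣τ∣) , _ , ρ∈L with find ρ∈L
    ... | H , H∈L , ρ⊆H = H , H∈L , ρ , suc-injective (trans ∣ρ∣+1≡∣τ∣ (All.head (All.++⁻ʳ L sizes))) , ρ⊆τ , ρ⊆H
    go : ∀ {F G} → F ∈ₗ L ⊎ F ∈ₗ τ ∷ [] → G ∈ₗ L ⊎ G ∈ₗ τ ∷ [] → C F → C G
    go (inj₁ F∈L) (inj₁ G∈L) = connected F∈L G∈L
    go (inj₁ F∈L) (inj₂ (here refl)) CF with neighbour F∈L
    ... | H , H∈L , ρ , ∣ρ∣≡n , ρ⊆τ , ρ⊆H = adjacent (∈-++⁺ˡ H∈L) τ∈L+τ ∣ρ∣≡n ρ⊆H ρ⊆τ (connected F∈L H∈L CF)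
    go (inj₂ (here refl)) (inj₁ G∈L) Cτ with neighbour G∈L
    ... | H , H∈L , ρ , ∣ρ∣≡n , ρ⊆τ , ρ⊆H = connected H∈L G∈L (adjacent τ∈L+τ (∈-++⁺ˡ H∈L) ∣ρ∣≡n ρ⊆τ ρ⊆H Cτ)
    go (inj₂ (here refl)) (inj₂ (here refl)) Cτ = Cτ

-- Boundaries of chains of facets

-- The coefficient of ρ in the mod-2 boundary of the chain c, when ρ is a ridge of its members.
boundary : List (Subset v) → Subset v → Bool
boundary c ρ = ∑[ i < length c ] does (ρ ⊆? lookup c i)

∑-link-facet : ∀ {μ F : Subset v} → ∣ F ∣ ≡ 2 + ∣ μ ∣ →
  ∑[ w < v ] (not (does (w ∈? μ)) ∧ does (μ ∪ ⁅ w ⁆ ⊆? F)) ≡ false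
∑-link-facet {v = v} {μ} {F} ∣F∣≡2+∣μ∣ with μ ⊆? F
... | no μ⊈F = trans (sum-cong-≗ vanish) (sum-replicate-zero v)
  where
    vanish : ∀ w → not (does (w ∈? μ)) ∧ does (μ ∪ ⁅ w ⁆ ⊆? F) ≡ false
    vanish w = trans (cong (not (does (w ∈? μ)) ∧_) (dec-false (μ ∪ ⁅ w ⁆ ⊆? F) (λ μ+w⊆F → μ⊈F λ x∈μ → μ+w⊆F (p⊆p∪q _ x∈μ))))
                     (∧-zeroʳ _)
... | yes μ⊆F = begin
  ∑[ w < v ] (not (does (w ∈? μ)) ∧ does (μ ∪ ⁅ w ⁆ ⊆? F))
    ≡⟨ sum-cong-≗ (λ w → does-⇔ (link⇔ w) (¬? (w ∈? μ) ×-dec (μ ∪ ⁅ w ⁆ ⊆? F)) (w ∈? F ─ μ)) ⟩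
  ∑[ w < v ] does (w ∈? F ─ μ)                                ≡⟨ ∑-∈ (F ─ μ) ⟩
  ∑[ i < ∣ F ─ μ ∣ ] true                                      ≡⟨ cong (λ k → ∑[ i < k ] true) ∣F─μ∣≡2 ⟩
  false                                                       ∎
  where
    open ≡-Reasoning
    link⇔ : ∀ w → (w ∉ μ × μ ∪ ⁅ w ⁆ ⊆ F) ⇔ w ∈ F ─ μ
    link⇔ w = mk⇔ (λ (w∉μ , μ+w⊆F) → x∈p∧x∉q⇒x∈p─q (μ+w⊆F x∈p∪⁅x⁆) w∉μ)
                  (λ w∈F─μ → x∈p─q⇒x∉q w∈F─μ , λ {x} → ∪⁅⁆-⊆ μ⊆F (p─q⊆p F μ w∈F─μ) {x})
    ∣F─μ∣≡2 : ∣ F ─ μ ∣ ≡ 2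
    ∣F─μ∣≡2 = +-cancelʳ-≡ _ _ _ (trans (sym (∣p∣≡∣p─q∣+∣q∣ F μ μ⊆F)) ∣F∣≡2+∣μ∣)

-- ∂∂ = 0, evaluated at the face μ.
∑-boundary-link≡false : ∀ {μ : Subset v} c → All (λ F → ∣ F ∣ ≡ 2 + ∣ μ ∣) c →
  ∑[ w < v ] (not (does (w ∈? μ)) ∧ boundary c (μ ∪ ⁅ w ⁆)) ≡ false
∑-boundary-link≡false {v = v} {μ} c sizes = begin
  ∑[ w < v ] (a w ∧ ∑[ i < length c ] b w i)   ≡⟨ sum-cong-≗ (λ w → *-distribˡ-sum (a w) (b w)) ⟩
  ∑[ w < v ] ∑[ i < length c ] (a w ∧ b w i)   ≡⟨ ∑-comm (λ w i → a w ∧ b w i) ⟩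
  ∑[ i < length c ] ∑[ w < v ] (a w ∧ b w i)
    ≡⟨ sum-cong-≗ (λ i → ∑-link-facet {μ = μ} {F = lookup c i} (All.lookup sizes (∈-lookup i))) ⟩
  ∑[ i < length c ] false                      ≡⟨ sum-replicate-zero (length c) ⟩
  false                                        ∎
  where
    open ≡-Reasoning
    a : Fin v → Bool
    a w = not (does (w ∈? μ))
    b : Fin v → Fin (length c) → Bool
    b w i = does (μ ∪ ⁅ w ⁆ ⊆? lookup c i)

boundary-swap : ∀ {τ : Subset v} {x y} c → All (λ F → ∣ F ∣ ≡ ∣ τ ∣) c → x ∈ τ → y ∈ τ → x ≢ y →
  (∀ w → w ∉ τ → boundary c ((τ - x - y) ∪ ⁅ w ⁆) ≡ false) → boundary c (τ - x) ≡ boundary c (τ - y)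
boundary-swap {v = v} {τ} {x} {y} c sizes x∈τ y∈τ x≢y vanish = sym (xor≡false⇒≡ _ _ (begin
  boundary c (τ - y) xor boundary c (τ - x)   ≡⟨ cong₂ _xor_ g[x] g[y] ⟨
  g x xor g y                                  ≡⟨ ∑-pair g x≢y g-vanish ⟨
  ∑[ w < v ] g w                               ≡⟨ ∑-boundary-link≡false c sizes′ ⟩
  false                                        ∎))
  where
    open ≡-Reasoning
    μ = τ - x - y
    g : Fin v → Bool
    g w = not (does (w ∈? μ)) ∧ boundary c (μ ∪ ⁅ w ⁆)
    sizes′ : All (λ F → ∣ F ∣ ≡ 2 + ∣ μ ∣) c
    sizes′ = All.map (λ ∣F∣≡∣τ∣ → trans ∣F∣≡∣τ∣ (∣p∣≡2+∣p-x-y∣ x∈τ y∈τ x≢y)) sizes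
    g[x] : g x ≡ boundary c (τ - y)
    g[x] = trans (cong (λ b → not b ∧ boundary c (μ ∪ ⁅ x ⁆)) (dec-false (x ∈? μ) λ x∈μ → x∈p-y⇒x≢y (p-x⊆p (τ - x) y x∈μ) refl))
                 (cong (boundary c) (trans (cong (_∪ ⁅ x ⁆) (p─x─y≡p─y─x τ x y)) (p-x∪⁅x⁆≡p (x∈p∧x≢y⇒x∈p-y x∈τ x≢y))))
    g[y] : g y ≡ boundary c (τ - x)
    g[y] = trans (cong (λ b → not b ∧ boundary c (μ ∪ ⁅ y ⁆)) (dec-false (y ∈? μ) λ y∈μ → x∈p-y⇒x≢y y∈μ refl))
                 (cong (boundary c) (p-x∪⁅x⁆≡p (x∈p∧x≢y⇒x∈p-y y∈τ (x≢y ∘ sym))))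
    g-vanish : ∀ w → w ≢ x → w ≢ y → g w ≡ false
    g-vanish w w≢x w≢y with w ∈? μ
    ... | yes _ = refl
    ... | no w∉μ = vanish w λ w∈τ → w∉μ (x∈p∧x≢y∧x≢z⇒x∈p-y-z w∈τ w≢x w≢y)

boundary≡false : ∀ c → (∀ {F} → F ∈ₗ c → ¬ (ρ ⊆ F)) → boundary c ρ ≡ false
boundary≡false [] _ = refl
boundary≡false {ρ = ρ} (F ∷ c) ρ⊈ = cong₂ _xor_ (dec-false (ρ ⊆? F) (ρ⊈ (here refl))) (boundary≡false c (ρ⊈ ∘ there))

boundary≡true : ∀ {F} c → Unique c → F ∈ₗ c → ρ ⊆ F → (∀ {G} → G ∈ₗ c → ρ ⊆ G → G ≡ F) → boundary c ρ ≡ true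
boundary≡true {ρ = ρ} (G ∷ c) (G∉c ∷ _) (here refl) ρ⊆G only =
  cong₂ _xor_ (dec-true (ρ ⊆? G) ρ⊆G) (boundary≡false c λ H∈c ρ⊆H → All.lookup G∉c H∈c (sym (only (there H∈c) ρ⊆H)))
boundary≡true {ρ = ρ} (G ∷ c) (G∉c ∷ c-unique) (there F∈c) ρ⊆F only =
  cong₂ _xor_ (dec-false (ρ ⊆? G) λ ρ⊆G → All.lookup G∉c F∈c (only (here refl) ρ⊆G))
              (boundary≡true c c-unique F∈c ρ⊆F (only ∘ there))

BoundaryIn : ℕ → List (Subset v) → List (Subset v) → Set
BoundaryIn n c P = ∀ ρ → ∣ ρ ∣ ≡ n → boundary c ρ ≡ true → Any (ρ ⊆_) P

OddMissingRidge : List (Subset v) → List (Subset v) → Subset v → Fin v → Set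
OddMissingRidge c P τ x = x ∈ τ × ¬ Any (τ - x ⊆_) P × boundary c (τ - x) ≡ true

oddMissingRidge? : ∀ c P (τ : Subset v) → Dec (∃ (OddMissingRidge c P τ))
oddMissingRidge? c P τ = any? λ x → x ∈? τ ×-dec ¬? (Any.any? (τ - x ⊆?_) P) ×-dec (boundary c (τ - x) Bool.≟ true)

module _ {n : ℕ} {c P : List (Subset v)} {τ : Subset v} (∣τ∣≡1+n : ∣ τ ∣ ≡ suc n) where

  ridge-of : ρ ⊆ τ → ∣ ρ ∣ ≡ n → ∃ λ x → x ∈ τ × ρ ≡ τ - x
  ridge-of ρ⊆τ ∣ρ∣≡n = Ridge⇒≡- (ρ⊆τ , trans (cong suc ∣ρ∣≡n) (sym ∣τ∣≡1+n))

  BoundaryIn-skip : BoundaryIn n c (P ∷ʳ τ) → ¬ ∃ (OddMissingRidge c P τ) → BoundaryIn n c P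
  BoundaryIn-skip boundary-in none ρ ∣ρ∣≡n odd with Any.any? (ρ ⊆?_) P
  ... | yes ρ∈P = ρ∈P
  ... | no ρ∉P with Any.++⁻ P (boundary-in ρ ∣ρ∣≡n odd)
  ...   | inj₁ ρ∈P = ⊥-elim (ρ∉P ρ∈P)
  ...   | inj₂ (here ρ⊆τ) with ridge-of ρ⊆τ ∣ρ∣≡n
  ...     | x , x∈τ , refl = ⊥-elim (none (x , x∈τ , ρ∉P , odd))

  -- An odd ridge through the meet of two missing ridges would lie in P, and so would the meet.
  missing-link-even : ∀ {x y} → (P ≢ [] → ShellStep P τ) → BoundaryIn n c (P ∷ʳ τ) → x ∈ τ → y ∈ τ → x ≢ y →
    ¬ Any (τ - x ⊆_) P → ¬ Any (τ - y ⊆_) P → ∀ w → w ∉ τ → boundary c ((τ - x - y) ∪ ⁅ w ⁆) ≡ false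
  missing-link-even {x} {y} step boundary-in x∈τ y∈τ x≢y x-missing y-missing w w∉τ = ¬-not λ μ+w-odd →
    case Any.++⁻ P (boundary-in _ ∣μ+w∣≡n μ+w-odd) of λ
      { (inj₁ μ+w∈P) → missing-ridges⇒missing-meet step x∈τ y∈τ x≢y x-missing y-missing (Any-⊆ˡ (p⊆p∪q _) μ+w∈P)
      ; (inj₂ (here μ+w⊆τ)) → w∉τ (μ+w⊆τ x∈p∪⁅x⁆) }
    where
      open ≡-Reasoning
      ∣μ+w∣≡n : ∣ (τ - x - y) ∪ ⁅ w ⁆ ∣ ≡ n
      ∣μ+w∣≡n = suc-injective (begin
        suc ∣ (τ - x - y) ∪ ⁅ w ⁆ ∣  ≡⟨ cong suc (∣p∪⁅x⁆∣≡suc∣p∣ λ w∈μ → w∉τ (p-x-y⊆p τ x y w∈μ)) ⟩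
        2 + ∣ τ - x - y ∣            ≡⟨ ∣p∣≡2+∣p-x-y∣ x∈τ y∈τ x≢y ⟨
        ∣ τ ∣                        ≡⟨ ∣τ∣≡1+n ⟩
        suc n                        ∎)

  BoundaryIn-add : ∀ {x₀} → (P ≢ [] → ShellStep P τ) → All (λ F → ∣ F ∣ ≡ suc n) c →
    BoundaryIn n c (P ∷ʳ τ) → OddMissingRidge c P τ x₀ → BoundaryIn n (τ ∷ c) P
  BoundaryIn-add {x₀} step sizes boundary-in (x₀∈τ , x₀-missing , x₀-odd) ρ ∣ρ∣≡n odd with Any.any? (ρ ⊆?_) P
  ... | yes ρ∈P = ρ∈P
  ... | no ρ∉P with ρ ⊆? τ
  ...   | no ρ⊈τ with Any.++⁻ P (boundary-in ρ ∣ρ∣≡n odd)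
  ...     | inj₁ ρ∈P = ⊥-elim (ρ∉P ρ∈P)
  ...     | inj₂ (here ρ⊆τ) = ⊥-elim (ρ⊈τ ρ⊆τ)
  BoundaryIn-add {x₀} step sizes boundary-in (x₀∈τ , x₀-missing , x₀-odd) ρ ∣ρ∣≡n odd | no ρ∉P | yes ρ⊆τ
    with ridge-of ρ⊆τ ∣ρ∣≡n
  ... | x , x∈τ , refl = case trans (sym even) (odd-in-c (x ≟ x₀)) of λ ()
    where
      -- Here odd : not (boundary c (τ - x)) ≡ true, as τ itself contains τ - x.
      even : boundary c (τ - x) ≡ false
      even = ¬-not λ odd-in-c → case trans (cong not (sym odd-in-c)) odd of λ ()
      odd-in-c : Dec (x ≡ x₀) → boundary c (τ - x) ≡ true
      odd-in-c (yes refl) = x₀-odd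
      odd-in-c (no x≢x₀) =
        trans (boundary-swap c (All.map (λ ∣F∣≡1+n → trans ∣F∣≡1+n (sym ∣τ∣≡1+n)) sizes) x∈τ x₀∈τ x≢x₀
                             (missing-link-even step boundary-in x∈τ x₀∈τ x≢x₀ ρ∉P x₀-missing))
              x₀-odd

CycleFrom : ℕ → List (Subset v) → List (Subset v) → Set
CycleFrom n P c = ∃ λ d → All (_∈ₗ P) d × Unique (d ++ c) × (∀ ρ → ∣ ρ ∣ ≡ n → boundary (d ++ c) ρ ≡ false)

-- Going down a shelling, each simplex is added to the chain exactly when it has an odd missing
-- ridge; its missing ridges all carry the same boundary, so this clears them all at once.
clear-boundary : ∀ {n} {P : List (Subset v)} → Reverse P → IsShelling P → Unique P → All (λ F → ∣ F ∣ ≡ suc n) P →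
  ∀ {c} → Unique c → All (_∉ₗ P) c → All (λ F → ∣ F ∣ ≡ suc n) c → BoundaryIn n c P → CycleFrom n P c
clear-boundary [] _ _ _ c-unique _ _ boundary-in =
  [] , [] , c-unique , λ ρ ∣ρ∣≡n → ¬-not λ odd → case boundary-in ρ ∣ρ∣≡n odd of λ ()
clear-boundary {n = n} (P ∶ rest ∶ʳ τ) shelling unique sizes {c} c-unique c∉P+τ c-sizes boundary-in =
  continue (oddMissingRidge? c P τ)
  where
    ∣τ∣≡1+n : ∣ τ ∣ ≡ suc n
    ∣τ∣≡1+n = All.head (All.++⁻ʳ P sizes)
    τ∈P+τ : τ ∈ₗ P ∷ʳ τ
    τ∈P+τ = ∈-++⁺ʳ P (here refl)
    clear-rest : ∀ {c′} → Unique c′ → All (_∉ₗ P) c′ → All (λ F → ∣ F ∣ ≡ suc n) c′ → BoundaryIn n c′ P → CycleFrom n P c′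
    clear-rest = clear-boundary rest (proj₁ (IsShelling-∷ʳ⁻ shelling)) (AllPairs-++⁻ˡ P unique) (All.++⁻ˡ P sizes)
    c∉P : All (_∉ₗ P) c
    c∉P = All.map (λ F∉P+τ → F∉P+τ ∘ ∈-++⁺ˡ) c∉P+τ
    τ∉c : All (τ ≢_) c
    τ∉c = All.tabulate λ F∈c τ≡F → All.lookup c∉P+τ F∈c (subst (_∈ₗ P ∷ʳ τ) τ≡F τ∈P+τ)
    continue : Dec (∃ (OddMissingRidge c P τ)) → CycleFrom n (P ∷ʳ τ) c
    continue (no none) with clear-rest c-unique c∉P c-sizes (BoundaryIn-skip {c = c} {P = P} ∣τ∣≡1+n boundary-in none)
    ... | d , d∈P , d++c-unique , cycle = d , All.map ∈-++⁺ˡ d∈P , d++c-unique , cycle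
    continue (yes (_ , odd-missing)) with clear-rest (τ∉c ∷ c-unique) (∉-∷ʳ unique ∷ c∉P) (∣τ∣≡1+n ∷ c-sizes)
      (BoundaryIn-add {c = c} {P = P} ∣τ∣≡1+n (proj₂ (IsShelling-∷ʳ⁻ shelling)) c-sizes boundary-in odd-missing)
    ... | d , d∈P , d++τc-unique , cycle =
      d ∷ʳ τ , All.++⁺ (All.map ∈-++⁺ˡ d∈P) (τ∈P+τ ∷ []) ,
      subst Unique (sym (++-assoc d (τ ∷ []) c)) d++τc-unique ,
      λ ρ ∣ρ∣≡n → trans (cong (λ z → boundary z ρ) (++-assoc d (τ ∷ []) c)) (cycle ρ ∣ρ∣≡n)

full-restriction⇒cycle : ∀ {n} {pre : List (Subset v)} {σ} → IsShelling pre → Unique (pre ∷ʳ σ) →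
  All (λ F → ∣ F ∣ ≡ suc n) (pre ∷ʳ σ) → (∀ {x} → x ∈ σ → Any (σ - x ⊆_) pre) → CycleFrom n pre (σ ∷ [])
full-restriction⇒cycle {n = n} {pre = pre} {σ = σ} shelling unique sizes full =
  clear-boundary (reverseView pre) shelling (AllPairs-++⁻ˡ pre unique) (All.++⁻ˡ pre sizes)
                 ([] ∷ []) (∉-∷ʳ unique ∷ []) (∣σ∣≡1+n ∷ []) boundary-in
  where
    ∣σ∣≡1+n : ∣ σ ∣ ≡ suc n
    ∣σ∣≡1+n = All.head (All.++⁻ʳ pre sizes)
    boundary-in : BoundaryIn n (σ ∷ []) pre
    boundary-in ρ ∣ρ∣≡n odd with ρ ⊆? σ
    ... | yes ρ⊆σ with Ridge⇒≡- (ρ⊆σ , trans (cong suc ∣ρ∣≡n) (sym ∣σ∣≡1+n))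
    ...   | x , x∈σ , refl = full x∈σ

module ShelledPseudoManifold (K : SimplicialComplex v) {n} (1≤n : 1 ≤ n) (pm : ClosedPseudoManifold K n) where

  open PseudoManifold K 1≤n pm

  cycle-closed : ∀ {z} → Unique z → All (Facet K) z → (∀ ρ → ∣ ρ ∣ ≡ n → boundary z ρ ≡ false) →
    ∀ {F G ρ} → F ∈ₗ z → Facet K G → ∣ ρ ∣ ≡ n → ρ ⊆ F → ρ ⊆ G → G ∈ₗ z
  cycle-closed {z} unique facets cycle {F} {G} {ρ} F∈z G-facet ∣ρ∣≡n ρ⊆F ρ⊆G with Any.any? (G ≟ˢ_) z
  ... | yes G∈z = G∈z
  ... | no G∉z = case trans (sym (cycle ρ ∣ρ∣≡n)) (boundary≡true z unique F∈z ρ⊆F only) of λ ()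
    where
      F-facet = All.lookup facets F∈z
      ρ∈K : face K ρ
      ρ∈K = downClosed K (proj₁ F-facet) ρ⊆F (0<∣p∣⇒Nonempty (subst (0 <_) (sym ∣ρ∣≡n) 1≤n))
      only : ∀ {X} → X ∈ₗ z → ρ ⊆ X → X ≡ F
      only X∈z ρ⊆X with opposite-facet ρ∈K ∣ρ∣≡n F-facet ρ⊆F
      ... | _ , _ , _ , _ , through-ρ with through-ρ G G-facet ρ⊆G | through-ρ _ (All.lookup facets X∈z) ρ⊆X
      ... | inj₁ refl | _ = ⊥-elim (G∉z F∈z)
      ... | inj₂ _ | inj₁ X≡F = X≡F
      ... | inj₂ refl | inj₂ refl = ⊥-elim (G∉z X∈z)

  module _ {σs} (facets : All (Facet K) σs) (unique : Unique σs) (shelling : IsShelling σs) where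

    cycle⊇shelling : ∀ {z F G} → Unique z → All (Facet K) z → (∀ ρ → ∣ ρ ∣ ≡ n → boundary z ρ ≡ false) →
      F ∈ₗ σs → F ∈ₗ z → G ∈ₗ σs → G ∈ₗ z
    cycle⊇shelling z-unique z-facets z-cycle F∈σs F∈z G∈σs =
      shelling-connected (reverseView σs) shelling (All.map facet-size facets) (_∈ₗ _)
        (λ _ H∈σs ∣ρ∣≡n ρ⊆H′ ρ⊆H H′∈z → cycle-closed z-unique z-facets z-cycle H′∈z (All.lookup facets H∈σs) ∣ρ∣≡n ρ⊆H′ ρ⊆H)
        F∈σs G∈σs F∈z

    full-restriction⇒last : ∀ {pre σ post} → σs ≡ pre ++ σ ∷ post → (∀ {x} → x ∈ σ → Any (σ - x ⊆_) pre) → post ≡ []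
    full-restriction⇒last {post = []} _ _ = refl
    full-restriction⇒last {pre} {σ} {p ∷ post} σs≡ full = ⊥-elim (All.head (All.lookup separated p∈pre+σ) refl)
      where
        σs≡′ : σs ≡ (pre ∷ʳ σ) ++ p ∷ post
        σs≡′ = trans σs≡ (sym (++-assoc pre (σ ∷ []) (p ∷ post)))
        separated : All (λ F → All (F ≢_) (p ∷ post)) (pre ∷ʳ σ)
        separated = AllPairs-++⇒All-All (pre ∷ʳ σ) (subst Unique σs≡′ unique)
        pre+σ⊆σs : ∀ {F} → F ∈ₗ pre ∷ʳ σ → F ∈ₗ σs
        pre+σ⊆σs F∈ = subst (_ ∈ₗ_) (sym σs≡′) (∈-++⁺ˡ F∈)
        cycle : CycleFrom n pre (σ ∷ [])
        cycle = full-restriction⇒cycle (IsShelling-++⁻ˡ pre (subst IsShelling σs≡ shelling))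
                  (AllPairs-++⁻ˡ (pre ∷ʳ σ) (subst Unique σs≡′ unique))
                  (All.++⁻ˡ (pre ∷ʳ σ) (subst (All _) σs≡′ (All.map facet-size facets))) full
        d = proj₁ cycle
        z⊆pre+σ : All (_∈ₗ pre ∷ʳ σ) (d ++ σ ∷ [])
        z⊆pre+σ = All.++⁺ (All.map ∈-++⁺ˡ (proj₁ (proj₂ cycle))) (∈-++⁺ʳ pre (here refl) ∷ [])
        p∈pre+σ : p ∈ₗ pre ∷ʳ σ
        p∈pre+σ = All.lookup z⊆pre+σ
          (cycle⊇shelling (proj₁ (proj₂ (proj₂ cycle))) (All.map (All.lookup facets ∘ pre+σ⊆σs) z⊆pre+σ)
                          (proj₂ (proj₂ (proj₂ cycle))) (∈-split σs≡) (∈-++⁺ʳ d (here refl)) (∈-split σs≡′))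

-- From a shellable h-tiling to a shelling

module ShellableTiling (K : SimplicialComplex v) {n} (1≤n : 1 ≤ n) (pm : ClosedPseudoManifold K n)
                       {ts : List (Tile v)} (tiling : ShellableHTiling K ts) where

  open PseudoManifold K 1≤n pm

  private
    tiles-ok : All (λ t → face K (simplex t) × IsHTile t) ts
    tiles-ok = proj₁ (proj₁ tiling)
    partition : Partition ts
    partition = proj₁ (proj₂ (proj₂ (proj₁ tiling)))
    above-closed : ∀ d → Closed (UnionDimAbove d ts)
    above-closed = proj₂ (proj₂ (proj₂ (proj₂ (proj₁ tiling))))

  covers : face K τ → Union ts τ
  covers {τ = τ} τ∈K with proj₁ (proj₂ (proj₁ tiling)) τ τ∈K
  ... | i , τ∈tile = lose (∈-lookup i) τ∈tile

  module _ {t} (t∈ts : t ∈ₗ ts) where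

    tile-face : face K (simplex t)
    tile-face = proj₁ (All.lookup tiles-ok t∈ts)

    tile-cell⇒⊆ : cell t τ → Nonempty τ × τ ⊆ simplex t
    tile-cell⇒⊆ = HTile-cell⇒⊆ (proj₂ (All.lookup tiles-ok t∈ts))

    tile-simplex∈cell : cell t (simplex t)
    tile-simplex∈cell = HTile-simplex∈cell (proj₂ (All.lookup tiles-ok t∈ts)) (nonempty K tile-face)

  facet-tile : ∀ {F} → Facet K F → ∃ λ t → t ∈ₗ ts × cell t F × simplex t ≡ F
  facet-tile F-facet with find (covers (proj₁ F-facet))
  ... | t , t∈ts , F∈t = t , t∈ts , F∈t , proj₂ F-facet _ (tile-face t∈ts) (proj₂ (tile-cell⇒⊆ t∈ts F∈t))

  above⇒large : ∀ {t d} → t ∈ₗ ts → cell t τ → UnionDimAbove d ts τ → suc d < ∣ simplex t ∣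
  above⇒large t∈ts τ∈t τ-above with find τ-above
  ... | t′ , t′∈ts , large , τ∈t′ =
    subst (λ u → suc _ < ∣ simplex u ∣) (Partition⇒cell-unique partition t′∈ts t∈ts τ∈t′ τ∈t) large

  -- Closedness of the union of the tiles of dimension ≥ n forces every tile to be n-dimensional.
  tile-facet : ∀ {t} → t ∈ₗ ts → Facet K (simplex t)
  tile-facet {t} t∈ts with face⇒⊆Facet K (tile-face t∈ts)
  ... | F , F-facet , σ⊆F with facet-tile F-facet
  ... | t′ , t′∈ts , F∈t′ , σ′≡F = subst (Facet K) (sym σ≡F) F-facet
    where
      suc-pred-n : suc (pred n) ≡ n
      suc-pred-n = suc-pred n {{>-nonZero 1≤n}}
      F-large : suc (pred n) < ∣ simplex t′ ∣
      F-large = subst₂ _<_ (sym suc-pred-n) (sym (trans (cong ∣_∣ σ′≡F) (facet-size F-facet))) (n<1+n n)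
      σ-large : suc (pred n) < ∣ simplex t ∣
      σ-large = above⇒large t∈ts (tile-simplex∈cell t∈ts)
                  (above-closed (pred n) F (simplex t) (lose t′∈ts (F-large , F∈t′)) (nonempty K (tile-face t∈ts)) σ⊆F)
      σ≡F : simplex t ≡ F
      σ≡F = ⊆∧∣≥∣⇒≡ σ⊆F (≤-trans (≤-reflexive (facet-size F-facet)) (subst (_< ∣ simplex t ∣) suc-pred-n σ-large))

  prefix-closed : ∀ A {B} → ts ≡ A ++ B → Closed (Union A)
  prefix-closed A ts≡ = subst (Closed ∘ Union) (trans (cong (take (length A)) ts≡) (take-length-++ A)) (proj₂ tiling (length A))

  prefix-Union⇔ : ∀ A {B} → ts ≡ A ++ B → Nonempty τ → Union A τ ⇔ Any (τ ⊆_) (map simplex A)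
  prefix-Union⇔ {τ = τ} A ts≡ τ-nonempty = mk⇔ to′ from′
    where
      in-ts : ∀ {a} → a ∈ₗ A → a ∈ₗ ts
      in-ts a∈A = subst (_ ∈ₗ_) (sym ts≡) (∈-++⁺ˡ a∈A)
      to′ : Union A τ → Any (τ ⊆_) (map simplex A)
      to′ τ∈A with find τ∈A
      ... | a , a∈A , τ∈a = Any.map⁺ (lose a∈A (proj₂ (tile-cell⇒⊆ (in-ts a∈A) τ∈a)))
      from′ : Any (τ ⊆_) (map simplex A) → Union A τ
      from′ τ⊆A with find (Any.map⁻ τ⊆A)
      ... | a , a∈A , τ⊆a = prefix-closed A ts≡ (simplex a) τ (lose a∈A (tile-simplex∈cell (in-ts a∈A))) τ-nonempty τ⊆a

  module Split {A t B} (ts≡ : ts ≡ A ++ t ∷ B) where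

    t∈ts : t ∈ₗ ts
    t∈ts = ∈-split ts≡

    prefix-disjoint : cell t τ → ¬ Union A τ
    prefix-disjoint τ∈t τ∈A with find τ∈A
    ... | a , a∈A , τ∈a =
      All.head (All.lookup (AllPairs-++⇒All-All A (subst (AllPairs DisjointCells) ts≡ (Partition⇒AllPairs ts partition))) a∈A) τ∈a τ∈t

    cell-or-prefix : Nonempty τ → τ ⊆ simplex t → cell t τ ⊎ Union A τ
    cell-or-prefix τ-nonempty τ⊆σ
      with Any.++⁻ A (prefix-closed (A ∷ʳ t) (trans ts≡ (sym (++-assoc A (t ∷ []) B))) (simplex t) _
                        (Any.++⁺ʳ A (here (tile-simplex∈cell t∈ts))) τ-nonempty τ⊆σ)
    ... | inj₁ τ∈A = inj₂ τ∈A
    ... | inj₂ (here τ∈t) = inj₁ τ∈t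

    tile-attached : ∀ S → (∀ τ → cell t τ ⇔ BasicCells (simplex t) S τ) → AttachedAlong (map simplex A) (simplex t) S
    tile-attached S cells τ τ-nonempty τ⊆σ = mk⇔ to′ from′
      where
        to′ : Any (τ ⊆_) (map simplex A) → ∃ λ x → x ∈ S × τ ⊆ simplex t - x
        to′ τ⊆A with any? (λ x → x ∈? S ×-dec τ ⊆? simplex t - x)
        ... | yes cut = cut
        ... | no uncut = ⊥-elim (prefix-disjoint (from (cells τ) (τ-nonempty , τ⊆σ , λ x x∈S τ⊆σ-x → uncut (x , x∈S , τ⊆σ-x)))
                                                 (from (prefix-Union⇔ A ts≡ τ-nonempty) τ⊆A))
        from′ : (∃ λ x → x ∈ S × τ ⊆ simplex t - x) → Any (τ ⊆_) (map simplex A)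
        from′ (x , x∈S , τ⊆σ-x) with cell-or-prefix τ-nonempty τ⊆σ
        ... | inj₁ τ∈t = ⊥-elim (proj₂ (proj₂ (to (cells τ) τ∈t)) x x∈S τ⊆σ-x)
        ... | inj₂ τ∈A = to (prefix-Union⇔ A ts≡ τ-nonempty) τ∈A

  first-closed : ∀ {t B} → ts ≡ t ∷ B → IsClosedTile t
  first-closed {t} ts≡ τ = mk⇔ (tile-cell⇒⊆ t∈ts) λ (τ-nonempty , τ⊆σ) → earliest (cell-or-prefix τ-nonempty τ⊆σ)
    where
      open Split {A = []} ts≡
      earliest : cell t τ ⊎ Union [] τ → cell t τ
      earliest (inj₁ τ∈t) = τ∈t

  -- A proper face of the last facet lies in another facet, which is covered by an earlier
  -- tile; the closure of the earlier tiles then contains the face.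
  last-open : ∀ {A t} → ts ≡ A ∷ʳ t → IsOpenTile t
  last-open {A} {t} ts≡ τ = mk⇔ (only (tile-facet t∈ts)) λ { refl → tile-simplex∈cell t∈ts }
    where
      open Split {A = A} {t = t} {B = []} ts≡
      only : Facet K (simplex t) → cell t τ → τ ≡ simplex t
      only σ-facet τ∈t with tile-cell⇒⊆ t∈ts τ∈t
      ... | τ-nonempty , τ⊆σ with simplex t ⊆? τ
      ... | yes σ⊆τ = ⊆-antisym τ⊆σ σ⊆τ
      ... | no σ⊈τ with proper-face⇒other-facet σ-facet τ⊆σ σ⊈τ
      ... | G , G-facet , G≢σ , τ⊆G with facet-tile G-facet
      ... | t′ , t′∈ts , G∈t′ , σ′≡G with ∈-++⁻ A (subst (t′ ∈ₗ_) ts≡ t′∈ts)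
      ... | inj₂ (here t′≡t) = ⊥-elim (G≢σ (trans (sym σ′≡G) (cong simplex t′≡t)))
      ... | inj₁ t′∈A = ⊥-elim (prefix-disjoint τ∈t (prefix-closed A ts≡ G τ (lose t′∈A G∈t′) τ-nonempty τ⊆G))

  first-critical : ∀ {t B} → ts ≡ t ∷ B → IsCriticalTile t
  first-critical ts≡ = closed⇒critical (nonempty K (tile-face (Split.t∈ts {A = []} ts≡))) (first-closed ts≡)

  last-critical : ∀ {A t} → ts ≡ A ∷ʳ t → IsCriticalTile t
  last-critical {A} {t} ts≡ =
    open⇒critical (proj₂ (nonempty K (tile-face (Split.t∈ts {A = A} {t = t} {B = []} ts≡)))) (last-open ts≡)

  single-tile⇒simplex≡ : ∀ {t F} → ts ≡ t ∷ [] → Facet K F → simplex t ≡ F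
  single-tile⇒simplex≡ ts≡[t] F-facet = case facet-tile F-facet of λ
    { (t′ , t′∈ts , _ , σ′≡F) → case subst (_ ∈ₗ_) ts≡[t] t′∈ts of λ
      { (here t′≡t) → trans (cong simplex (sym t′≡t)) σ′≡F
      ; (there ()) } }

  ends : ∃ λ t₀ → ∃ λ M → ∃ λ t₁ → ts ≡ t₀ ∷ M ∷ʳ t₁
  ends = case two-facets of λ
    { (F , G , F-facet , G-facet , F≢G) → ∷-∷ʳ-view ts
        (λ ts≡[] → case subst (λ l → Union l F) ts≡[] (covers (proj₁ F-facet)) of λ ())
        (λ t ts≡[t] → F≢G (trans (sym (single-tile⇒simplex≡ ts≡[t] F-facet)) (single-tile⇒simplex≡ ts≡[t] G-facet))) }

  count-ends : ∀ {c} → CountCritical ts c →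
    ∃ λ t₀ → ∃ λ M → ∃ λ t₁ → ts ≡ t₀ ∷ M ∷ʳ t₁ × ∃ λ k → c ≡ 2 + k × CountCritical M k
  count-ends count =
    let t₀ , M , t₁ , ts≡ = ends
    in t₀ , M , t₁ , ts≡ , CountCritical-ends⁻ M (subst (λ l → CountCritical l _) ts≡ count)
                                                (first-critical ts≡) (last-critical {A = t₀ ∷ M} ts≡)

  at-least-two-critical : ∀ {c} → CountCritical ts c → 2 ≤ c
  at-least-two-critical count =
    let _ , _ , _ , _ , k , c≡2+k , _ = count-ends count in subst (2 ≤_) (sym c≡2+k) (m≤m+n 2 k)

  middle-noncritical : ∀ {a A t b B} → CountCritical ts 2 → ts ≡ a ∷ A ++ t ∷ b ∷ B → ¬ IsCriticalTile t
  middle-noncritical count ts≡ =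
    let _ , M , _ , ts≡′ , k , 2≡2+k , count-M = count-ends count
    in All.lookup (to CountCritical-zero⇔ (subst (CountCritical M) (+-cancelˡ-≡ 2 k 0 (sym 2≡2+k)) count-M))
                  (∈-init M _ (∷-injectiveʳ (trans (sym ts≡′) ts≡)))

  later-tile-basic : ∀ {A t B} → CountCritical ts 2 → ts ≡ A ++ t ∷ B → A ≢ [] →
    ∃ λ S → S ⊆ simplex t × Nonempty S × (∀ τ → cell t τ ⇔ BasicCells (simplex t) S τ)
  later-tile-basic {A} {t} {[]} _ ts≡ _ =
    simplex t , (λ x∈σ → x∈σ) , σ-nonempty , proj₂ (proj₂ (open⇒basic σ-nonempty (last-open ts≡)))
    where σ-nonempty = nonempty K (tile-face (Split.t∈ts {A = A} {t = t} {B = []} ts≡))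
  later-tile-basic {[]} {B = _ ∷ _} _ _ A≢[] = ⊥-elim (A≢[] refl)
  later-tile-basic {a ∷ A} {t} {b ∷ B} count ts≡ _ =
    noncritical⇒basic (proj₂ (All.lookup tiles-ok t∈ts)) (nonempty K (tile-face t∈ts)) (middle-noncritical count ts≡)
    where t∈ts = Split.t∈ts {A = a ∷ A} {t = t} {B = b ∷ B} ts≡

  two-critical⇒Shellable : CountCritical ts 2 → Shellable K
  two-critical⇒Shellable count =
    map simplex ts , All.map⁺ (All.tabulate tile-facet) , complete ,
    distinct-simplices (All.tabulate tile-simplex∈cell) (Partition⇒AllPairs ts partition) , IsShelling-map⁺ simplex ts step
    where
      complete : ∀ F → Facet K F → F ∈ₗ map simplex ts
      complete F F-facet with facet-tile F-facet
      ... | t , t∈ts , _ , σ≡F = subst (_∈ₗ map simplex ts) σ≡F (∈-map⁺ simplex t∈ts)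
      step : ∀ A t B → ts ≡ A ++ t ∷ B → A ≢ [] → ShellStep (map simplex A) (simplex t)
      step A t B ts≡ A≢[] with later-tile-basic count ts≡ A≢[]
      ... | S , S⊆σ , S-nonempty , cells =
        AttachedAlong⇒ShellStep (tile-attached S cells) S⊆σ S-nonempty (ridge-nonempty (tile-facet t∈ts))
        where open Split {A = A} {t = t} {B = B} ts≡

-- From a shelling to a shellable h-tiling

shellTile : List (Subset v) → Subset v → Tile v
shellTile pre σ = record { simplex = σ ; cell = λ τ → Nonempty τ × τ ⊆ σ × ¬ Any (τ ⊆_) pre }

shellTiles : List (Subset v) → List (Subset v) → List (Tile v)
shellTiles pre [] = []
shellTiles pre (σ ∷ σs) = shellTile pre σ ∷ shellTiles (pre ∷ʳ σ) σs

Union-shellTiles⇔ : ∀ pre σs → Union (shellTiles pre σs) τ ⇔ (Nonempty τ × ¬ Any (τ ⊆_) pre × Any (τ ⊆_) σs)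
Union-shellTiles⇔ {τ = τ} pre σs = mk⇔ (to′ pre σs) (from′ pre σs)
  where
    to′ : ∀ pre σs → Union (shellTiles pre σs) τ → Nonempty τ × ¬ Any (τ ⊆_) pre × Any (τ ⊆_) σs
    to′ pre (σ ∷ σs) (here (τ-nonempty , τ⊆σ , τ∉pre)) = τ-nonempty , τ∉pre , here τ⊆σ
    to′ pre (σ ∷ σs) (there τ∈later) with to′ (pre ∷ʳ σ) σs τ∈later
    ... | τ-nonempty , τ∉pre+σ , τ∈σs = τ-nonempty , τ∉pre+σ ∘ Any.++⁺ˡ , there τ∈σs
    from′ : ∀ pre σs → Nonempty τ × ¬ Any (τ ⊆_) pre × Any (τ ⊆_) σs → Union (shellTiles pre σs) τ
    from′ pre (σ ∷ σs) (τ-nonempty , τ∉pre , τ∈σ∷σs) with τ ⊆? σ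
    ... | yes τ⊆σ = here (τ-nonempty , τ⊆σ , τ∉pre)
    ... | no τ⊈σ = there (from′ (pre ∷ʳ σ) σs (τ-nonempty , τ∉pre+σ , τ∈σs τ∈σ∷σs))
      where
        τ∈σs : Any (τ ⊆_) (σ ∷ σs) → Any (τ ⊆_) σs
        τ∈σs (here τ⊆σ) = ⊥-elim (τ⊈σ τ⊆σ)
        τ∈σs (there τ∈σs) = τ∈σs
        τ∉pre+σ : ¬ Any (τ ⊆_) (pre ∷ʳ σ)
        τ∉pre+σ τ∈pre+σ with Any.++⁻ pre τ∈pre+σ
        ... | inj₁ τ∈pre = τ∉pre τ∈pre
        ... | inj₂ (here τ⊆σ) = τ⊈σ τ⊆σ

take-shellTiles : ∀ p pre (σs : List (Subset v)) → take p (shellTiles pre σs) ≡ shellTiles pre (take p σs)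
take-shellTiles zero pre σs = refl
take-shellTiles (suc p) pre [] = refl
take-shellTiles (suc p) pre (σ ∷ σs) = cong (shellTile pre σ ∷_) (take-shellTiles p (pre ∷ʳ σ) σs)

shellTiles-∷ʳ : ∀ pre (σs : List (Subset v)) {σ} → shellTiles pre (σs ∷ʳ σ) ≡ shellTiles pre σs ∷ʳ shellTile (pre ++ σs) σ
shellTiles-∷ʳ pre [] {σ} = cong (λ l → shellTile l σ ∷ []) (sym (++-identityʳ pre))
shellTiles-∷ʳ pre (σ′ ∷ σs) {σ} =
  cong (shellTile pre σ′ ∷_)
       (trans (shellTiles-∷ʳ (pre ∷ʳ σ′) σs)
              (cong (λ l → shellTiles (pre ∷ʳ σ′) σs ∷ʳ shellTile l σ) (++-assoc pre (σ′ ∷ []) σs)))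

All-shellTiles : ∀ {p} {P : Tile v → Set p} pre σs → (∀ A σ B → σs ≡ A ++ σ ∷ B → P (shellTile (pre ++ A) σ)) →
  All P (shellTiles pre σs)
All-shellTiles pre [] _ = []
All-shellTiles {P = P} pre (σ ∷ σs) P-at =
  subst P (cong (λ l → shellTile l σ) (++-identityʳ pre)) (P-at [] σ σs refl) ∷
  All-shellTiles (pre ∷ʳ σ) σs λ A σ′ B σs≡ →
    subst P (cong (λ l → shellTile l σ′) (sym (++-assoc pre (σ ∷ []) A))) (P-at (σ ∷ A) σ′ B (cong (σ ∷_) σs≡))

shellTiles-disjoint : ∀ pre (σs : List (Subset v)) → AllPairs DisjointCells (shellTiles pre σs)
shellTiles-disjoint pre [] = []
shellTiles-disjoint pre (σ ∷ σs) =
  All.tabulate (λ t∈later τ∈t τ∈t′ → proj₁ (proj₂ (to (Union-shellTiles⇔ (pre ∷ʳ σ) σs) (lose t∈later τ∈t′)))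
                                         (Any.++⁺ʳ pre (here (proj₁ (proj₂ τ∈t))))) ∷
  shellTiles-disjoint (pre ∷ʳ σ) σs

shellTile-basic : ∀ {pre : List (Subset v)} {σ} → (pre ≢ [] → ShellStep pre σ) → IsBasicTile (shellTile pre σ)
shellTile-basic {pre = pre} {σ} step =
  restriction pre σ , (λ x∈R → proj₁ (to (∈-restriction⇔ {pre = pre} {σ}) x∈R)) , λ τ →
    mk⇔ (λ (τ-nonempty , τ⊆σ , τ∉pre) → τ-nonempty , τ⊆σ , λ x x∈R τ⊆σ-x →
           τ∉pre (from (attached τ τ-nonempty τ⊆σ) (x , x∈R , τ⊆σ-x)))
        (λ (τ-nonempty , τ⊆σ , uncut) → τ-nonempty , τ⊆σ , λ τ∈pre →
           case to (attached τ τ-nonempty τ⊆σ) τ∈pre of λ (x , x∈R , τ⊆σ-x) → uncut x x∈R τ⊆σ-x)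
  where attached = ShellStep⇒AttachedAlong-restriction step

module FromShelling (K : SimplicialComplex v) {n} (1≤n : 1 ≤ n) (pm : ClosedPseudoManifold K n)
                    {σs} (facets : All (Facet K) σs) (complete : ∀ σ → Facet K σ → σ ∈ₗ σs)
                    (unique : Unique σs) (shelling : IsShelling σs) where

  open PseudoManifold K 1≤n pm
  open ShelledPseudoManifold K 1≤n pm

  tiles : List (Tile v)
  tiles = shellTiles [] σs

  private
    Union⇔ : Union tiles τ ⇔ (Nonempty τ × ¬ Any (τ ⊆_) [] × Any (τ ⊆_) σs)
    Union⇔ = Union-shellTiles⇔ [] σs
    sizes : All (λ t → ∣ simplex t ∣ ≡ suc n) tiles
    sizes = All-shellTiles [] σs λ _ _ _ σs≡ → facet-size (All.lookup facets (∈-split σs≡))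

  tiles-face : Union tiles τ → face K τ
  tiles-face τ∈ with to Union⇔ τ∈
  ... | τ-nonempty , _ , τ∈σs with find τ∈σs
  ... | F , F∈σs , τ⊆F = downClosed K (proj₁ (All.lookup facets F∈σs)) τ⊆F τ-nonempty

  tiles-cover : face K τ → Union tiles τ
  tiles-cover τ∈K with face⇒⊆Facet K τ∈K
  ... | F , F-facet , τ⊆F = from Union⇔ (nonempty K τ∈K , (λ ()) , lose (complete F F-facet) τ⊆F)

  shellable-h-tiling : ShellableHTiling K tiles
  shellable-h-tiling =
    (All-shellTiles [] σs (λ A σ B σs≡ →
       proj₁ (All.lookup facets (∈-split σs≡)) , inj₁ (shellTile-basic (shelling A σ B σs≡))) ,
     (λ τ τ∈K → Any.index (tiles-cover τ∈K) , Any.lookup-index (tiles-cover τ∈K)) ,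
     AllPairs⇒Partition tiles (shellTiles-disjoint [] σs) ,
     (λ _ → tiles-face) ,
     above-closed) ,
    prefix-closed
    where
      above-closed : ∀ d → Closed (UnionDimAbove d tiles)
      above-closed d τ ρ τ∈ ρ-nonempty ρ⊆τ with find τ∈
      ... | t , t∈tiles , d<∣t∣ , τ∈t with find (tiles-cover (downClosed K (tiles-face (lose t∈tiles τ∈t)) ρ⊆τ ρ-nonempty))
      ... | t′ , t′∈tiles , ρ∈t′ =
        lose t′∈tiles (subst (suc d <_) (trans (All.lookup sizes t∈tiles) (sym (All.lookup sizes t′∈tiles))) d<∣t∣ , ρ∈t′)
      prefix-closed : ∀ p → Closed (Union (take p tiles))
      prefix-closed p rewrite take-shellTiles p [] σs = λ τ ρ τ∈ ρ-nonempty ρ⊆τ →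
        from (Union-shellTiles⇔ [] (take p σs))
             (ρ-nonempty , (λ ()) , Any-⊆ˡ ρ⊆τ (proj₂ (proj₂ (to (Union-shellTiles⇔ [] (take p σs)) τ∈))))

  first-critical : ∀ {σ} → σ ∈ₗ σs → IsCriticalTile (shellTile [] σ)
  first-critical {σ} σ∈σs = closed⇒critical (nonempty K (proj₁ (All.lookup facets σ∈σs))) λ τ → mk⇔ (map₂ proj₁) (in-first τ)
    where
      in-first : ∀ τ → Nonempty τ × τ ⊆ σ → cell (shellTile [] σ) τ
      in-first τ (τ-nonempty , τ⊆σ) = τ-nonempty , τ⊆σ , λ ()

  last-open : ∀ {A σ} → σs ≡ A ∷ʳ σ → IsOpenTile (shellTile A σ)
  last-open {A} {σ} σs≡ τ = mk⇔ (only σ-facet) λ { refl → nonempty K (proj₁ σ-facet) , (λ x∈σ → x∈σ) , σ∉A }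
    where
      σ-facet = All.lookup facets (∈-split σs≡)
      in-σs : ∀ {G} → G ∈ₗ A → G ∈ₗ σs
      in-σs G∈A = subst (_ ∈ₗ_) (sym σs≡) (∈-++⁺ˡ G∈A)
      σ∉A : ¬ Any (σ ⊆_) A
      σ∉A σ∈A with find σ∈A
      ... | G , G∈A , σ⊆G = ∉-∷ʳ (subst Unique σs≡ unique)
                                 (subst (_∈ₗ A) (proj₂ σ-facet G (proj₁ (All.lookup facets (in-σs G∈A))) σ⊆G) G∈A)
      only : Facet K σ → cell (shellTile A σ) τ → τ ≡ σ
      only σ-facet (τ-nonempty , τ⊆σ , τ∉A) with σ ⊆? τ
      ... | yes σ⊆τ = ⊆-antisym τ⊆σ σ⊆τ
      ... | no σ⊈τ with proper-face⇒other-facet σ-facet τ⊆σ σ⊈τ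
      ... | G , G-facet , G≢σ , τ⊆G with ∈-++⁻ A (subst (G ∈ₗ_) σs≡ (complete G G-facet))
      ... | inj₁ G∈A = ⊥-elim (τ∉A (lose G∈A τ⊆G))
      ... | inj₂ (here G≡σ) = ⊥-elim (G≢σ G≡σ)

  middle-noncritical : ∀ {A σ B} → σs ≡ A ++ σ ∷ B → A ≢ [] → B ≢ [] → ¬ IsCriticalTile (shellTile A σ)
  middle-noncritical {A} {σ} {B} σs≡ A≢[] B≢[] =
    basic⇒¬critical R (proj₁ (proj₂ basic)) (proj₂ (proj₂ basic)) R-nonempty (⊈⇒∃∉ σ⊈R)
    where
      R = restriction A σ
      basic = shellTile-basic (shelling A σ B σs≡)
      R-nonempty : Nonempty R
      R-nonempty with shelling A σ B σs≡ A≢[]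
      ... | (τ , τ-nonempty , τ⊆σ , τ∈A) , ridges with ridges τ τ-nonempty τ⊆σ τ∈A
      ... | ρ , ρ-ridge , _ , ρ∈A with Ridge⇒≡- ρ-ridge
      ... | x , x∈σ , refl = x , from (∈-restriction⇔ {pre = A} {σ}) (x∈σ , ρ∈A)
      σ⊈R : ¬ (σ ⊆ R)
      σ⊈R σ⊆R = B≢[] (full-restriction⇒last facets unique shelling σs≡ λ x∈σ →
                                 proj₂ (to (∈-restriction⇔ {pre = A} {σ}) (σ⊆R x∈σ)))

  ends : ∃ λ σ₁ → ∃ λ mid → ∃ λ σₙ → σs ≡ σ₁ ∷ mid ∷ʳ σₙ
  ends = case two-facets of λ
    { (F , G , F-facet , G-facet , F≢G) → ∷-∷ʳ-view σs
        (λ σs≡[] → case subst (F ∈ₗ_) σs≡[] (complete F F-facet) of λ ())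
        (λ σ σs≡[σ] → F≢G (trans (single σs≡[σ] (complete F F-facet)) (sym (single σs≡[σ] (complete G G-facet))))) }
    where
      single : ∀ {σ H} → σs ≡ σ ∷ [] → H ∈ₗ σs → H ≡ σ
      single σs≡[σ] H∈σs = case subst (_ ∈ₗ_) σs≡[σ] H∈σs of λ { (here H≡σ) → H≡σ ; (there ()) }

  two-critical : CountCritical tiles 2
  two-critical =
    subst (λ l → CountCritical (shellTiles [] l) 2) (sym σs≡)
      (subst (λ l → CountCritical (shellTile [] σ₁ ∷ l) 2) (sym (shellTiles-∷ʳ (σ₁ ∷ []) mid))
        (CountCritical-ends⁺ (All-shellTiles (σ₁ ∷ []) mid middle)
                             (first-critical (∈-split {ys = []} σs≡))
                             (open⇒critical σₙ-vertex (last-open σs≡))))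
    where
      σ₁ = proj₁ ends
      mid = proj₁ (proj₂ ends)
      σₙ = proj₁ (proj₂ (proj₂ ends))
      σs≡ : σs ≡ σ₁ ∷ mid ∷ʳ σₙ
      σs≡ = proj₂ (proj₂ (proj₂ ends))
      σₙ-vertex = proj₂ (nonempty K (proj₁ (All.lookup facets (∈-split {ys = σ₁ ∷ mid} σs≡))))
      middle : ∀ A σ B → mid ≡ A ++ σ ∷ B → ¬ IsCriticalTile (shellTile (σ₁ ∷ A) σ)
      middle A σ B mid≡ =
        middle-noncritical (trans σs≡ (cong (σ₁ ∷_) (trans (cong (_∷ʳ σₙ) mid≡) (++-assoc A (σ ∷ B) (σₙ ∷ [])))))
                           (λ ()) (∷ʳ≢[] B)

-- The shellable h-tiling assumed in the statement is already supplied by IsMu K m.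
proposition1p4 : ∀ {v} (K : SimplicialComplex v) (n : ℕ) → 1 ≤ n →
    ClosedPseudoManifold K n → (∃[ ts ] ShellableHTiling K ts) →
    ∀ m → IsMu K m → 2 ≤ m × (m ≡ 2 ⇔ Shellable K)
proposition1p4 K n 1≤n pm _ m ((ts , tiling , count) , minimal) = 2≤m , mk⇔ shellable m≡2
  where
    2≤m : 2 ≤ m
    2≤m = ShellableTiling.at-least-two-critical K 1≤n pm tiling count
    shellable : m ≡ 2 → Shellable K
    shellable refl = ShellableTiling.two-critical⇒Shellable K 1≤n pm tiling count
    m≡2 : Shellable K → m ≡ 2
    m≡2 (σs , facets , complete , unique , shelling) =
      ≤-antisym (minimal _ 2 shellable-h-tiling two-critical) 2≤m
      where open FromShelling K 1≤n pm facets complete unique shelling
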